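{- Let $B(x,y) := \sum_{n,m \geq 1} \frac{|\mathcal{B}_{n,m}|}{n!} x^n y^m$. Then the formal power series $B(x,y)$ satisfies $$\frac{\partial B}{\partial x}(x,y) = (y+1)e^{B(x,y)} - B(x,y) - 1, \qquad B(0,y) = 0.$$
   Context: For $n \ge m \ge 1$, $\mathcal B_{n,m}$ is the set of non-plane (unordered) labelled rooted trees on $n$ nodes such that: each node is labelled by a value in $\{0,\dots,n-1\}$, each such value labelling exactly one node; the tree is increasing (every non-root node has a greater label than its parent); each node is coloured blue or red, with exactly $m$ blue nodes and $n-m$ red nodes; and each red node has at least two children. For $n<m$, $\mathcal B_{n,m}=\emptyset$. -}

module Defs where

open import Data.Bool using (Bool; true; false; T)
open import Data.Nat as ℕ using (ℕ; zero; suc; _≤_; _!)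
open import Data.Nat.Properties using (_!≢0)
open import Data.Fin using (Fin; toℕ)
open import Data.List using (List; []; _∷_; upTo)
import Data.List as List
open import Data.Vec using (Vec; lookup; allFin; count)
open import Data.Vec.Relation.Unary.All using (All)
open import Data.Unit using (⊤)
open import Data.Integer using (+_)
open import Data.Rational using (ℚ; 0ℚ; 1ℚ; _+_; _-_; _*_; _/_)
open import Relation.Nullary.Decidable using (T?)
open import Relation.Binary.PropositionalEquality using (_≡_)

-- Increasing (non-plane) labelled rooted trees on node labels {0,…,n-1}.
--
-- A rooted labelled (non-plane) tree is given by its parent map.  In an
-- increasing tree the root is the node labelled 0 and every node i ≥ 1
-- has a parent with a smaller label, i.e. a parent in {0,…,i-1} = Fin i.
-- Such parent maps are exactly the increasing trees, so we encode a tree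
-- by the sequence of parents of nodes 1, 2, …, n-1:
--   root      : the tree with the single node 0
--   t ⊕ p     : t (on nodes 0..n-1) extended by node n, whose parent is p.
-- There is no tree with 0 nodes.

data IncTree : ℕ → Set where
  root : IncTree 1
  _⊕_  : ∀ {n} → IncTree n → Fin n → IncTree (suc n)

parents : ∀ {n} → IncTree n → List ℕ
parents root    = []
parents (t ⊕ p) = toℕ p ∷ parents t

children : ∀ {n} → IncTree n → Fin n → ℕ
children t j = List.length (List.filter (λ p → p ℕ.≟ toℕ j) (parents t))

-- colours: true = blue, false = red.  A red node needs ≥ 2 children.
ColourOK : Bool → ℕ → Set
ColourOK true  _ = ⊤
ColourOK false k = 2 ≤ k

record 𝓑 (n m : ℕ) : Set where
  field
    tree    : IncTree n
    colour  : Vec Bool n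
    blues   : count T? colour ≡ m
    redOK   : All (λ i → ColourOK (lookup colour i) (children tree i)) (allFin n)

-- Formal power series in x, y over ℚ: F n m = coefficient of xⁿ yᵐ.

Series : Set
Series = ℕ → ℕ → ℚ

Σℚ : List ℚ → ℚ
Σℚ = List.foldr _+_ 0ℚ

Σ≤ : ℕ → (ℕ → ℚ) → ℚ
Σ≤ n f = Σℚ (List.map f (upTo (suc n)))

fromℕ : ℕ → ℚ
fromℕ k = (+ k) / 1

inv! : ℕ → ℚ
inv! k = ((+ 1) / (k !)) {{k !≢0}}

oneS : Series
oneS zero zero = 1ℚ
oneS _    _    = 0ℚ

_⊞_ : Series → Series → Series
(F ⊞ G) n m = F n m + G n m

_⊟_ : Series → Series → Series
(F ⊟ G) n m = F n m - G n m

_⊠_ : Series → Series → Series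
(F ⊠ G) n m = Σ≤ n λ i → Σ≤ m λ j → F i j * G (n ℕ.∸ i) (m ℕ.∸ j)

_^S_ : Series → ℕ → Series
F ^S zero  = oneS
F ^S suc k = F ⊠ (F ^S k)

y+1⊠ : Series → Series
y+1⊠ F n zero    = F n zero
y+1⊠ F n (suc m) = F n (suc m) + F n m

∂x : Series → Series
∂x F n m = fromℕ (suc n) * F (suc n) m

-- e^F = Σ_k F^k / k!, for F with F(0,y) = 0 (no x⁰ terms): then
-- [xⁿ yᵐ] F^k = 0 for k > n, so the sum is finite, k = 0..n.
expS : Series → Series
expS F n m = Σ≤ n λ k → inv! k * (F ^S k) n m

Bseries : (ℕ → ℕ → ℕ) → Series
Bseries b zero    _       = 0ℚ
Bseries b (suc n) zero    = 0ℚ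
Bseries b (suc n) (suc m) = fromℕ (b (suc n) (suc m)) * inv! (suc n)

-- Let E count E-trees: increasing trees with a blue root in which every non-root red node has at
-- least two children, weighted by x^(nodes − 1) y^(blue nodes − 1) / (nodes − 1)!.  Removing the
-- root of an E-tree leaves a set of trees of 𝓑, so E should be e^B.  Cutting off the subtree of
-- node 1 shows E′ = B′ E with E(0, y) = 1, and e^B is the only solution of that equation.  Sorting
-- the trees of 𝓑 on n + 1 nodes by their root then gives ∂B/∂x + 1 + B = (y + 1) E: a blue root
-- makes the tree an E-tree; a red root, recoloured blue, gives an E-tree with one more blue and
-- root degree ≥ 2; and the E-trees whose root has a single child are the trees of 𝓑 on n nodes
-- below a new root.

module Submission where

open import Defs
open import Data.Nat using (ℕ; _≤_)
open import Data.Fin using (Fin)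
open import Data.Product using (_×_)
open import Data.Rational using (0ℚ)
open import Function.Bundles using (_↔_)
open import Relation.Binary.PropositionalEquality using (_≡_)

open import Data.Nat using (suc)
import Data.Nat.Properties as ℕₚ
import Data.Rational.Properties as ℚₚ
open import Algebra.Bundles using (CommutativeSemiring; CommutativeRing; CommutativeMonoid)
import Algebra.Properties.CommutativeSemigroup

module PowerSeries {c ℓ} (R : CommutativeSemiring c ℓ) where

  open import Data.Nat as ℕ using (zero; suc; _∸_; _<_; z≤n; s≤s)
  open import Data.Product using (_,_)
  import Relation.Binary.PropositionalEquality as ≡
  open import Relation.Binary.Structures using (IsEquivalence)
  open import Algebra.Structures.Biased using (IsCommutativeSemiringˡ)
  open CommutativeSemiring R
  open import Algebra.Properties.CommutativeSemigroup +-commutativeSemigroup using (interchange)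
  open import Algebra.Properties.Semiring.Mult semiring
    using (×-homo-+; ×-congʳ; ×-assoc-*; ×-comm-*) renaming (_×_ to _·_)
  open import Relation.Binary.Reasoning.Setoid setoid

  -- The trailing 0# makes ∑ unfold exactly like Defs.Σ≤, a foldr.
  ∑ : ℕ → (ℕ → Carrier) → Carrier
  ∑ zero    f = f 0 + 0#
  ∑ (suc n) f = f 0 + ∑ n (λ i → f (suc i))

  syntax ∑ n (λ i → x) = ∑[ i ≤ n ] x

  ∑-cong≤ : ∀ n {f g : ℕ → Carrier} → (∀ i → i ≤ n → f i ≈ g i) → ∑ n f ≈ ∑ n g
  ∑-cong≤ zero    f≈g = +-congʳ (f≈g 0 z≤n)
  ∑-cong≤ (suc n) f≈g = +-cong (f≈g 0 z≤n) (∑-cong≤ n (λ i i≤n → f≈g (suc i) (s≤s i≤n)))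

  ∑-cong : ∀ n {f g : ℕ → Carrier} → (∀ i → f i ≈ g i) → ∑ n f ≈ ∑ n g
  ∑-cong n f≈g = ∑-cong≤ n (λ i _ → f≈g i)

  ∑-zero : ∀ n {f : ℕ → Carrier} → (∀ i → i ≤ n → f i ≈ 0#) → ∑ n f ≈ 0#
  ∑-zero n f≈0 = trans (∑-cong≤ n f≈0) (zero-sum n)
    where
    zero-sum : ∀ n → ∑[ _ ≤ n ] 0# ≈ 0#
    zero-sum zero    = +-identityʳ 0#
    zero-sum (suc n) = trans (+-identityˡ _) (zero-sum n)

  ∑-distrib-+ : ∀ n (f g : ℕ → Carrier) → ∑[ i ≤ n ] (f i + g i) ≈ ∑ n f + ∑ n g
  ∑-distrib-+ zero f g = begin
    (f 0 + g 0) + 0#        ≈⟨ +-congˡ (+-identityʳ 0#) ⟨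
    (f 0 + g 0) + (0# + 0#) ≈⟨ interchange _ _ _ _ ⟩
    (f 0 + 0#) + (g 0 + 0#) ∎
  ∑-distrib-+ (suc n) f g = begin
    (f 0 + g 0) + ∑[ i ≤ n ] (f (suc i) + g (suc i)) ≈⟨ +-congˡ (∑-distrib-+ n _ _) ⟩
    (f 0 + g 0) + (∑ n _ + ∑ n _)                    ≈⟨ interchange _ _ _ _ ⟩
    (f 0 + ∑ n _) + (g 0 + ∑ n _)                    ∎

  *-distribˡ-∑ : ∀ n x (f : ℕ → Carrier) → x * ∑ n f ≈ ∑[ i ≤ n ] (x * f i)
  *-distribˡ-∑ zero x f = trans (distribˡ x (f 0) 0#) (+-congˡ (zeroʳ x))
  *-distribˡ-∑ (suc n) x f = trans (distribˡ x (f 0) _) (+-congˡ (*-distribˡ-∑ n x _))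

  *-distribʳ-∑ : ∀ n x (f : ℕ → Carrier) → ∑ n f * x ≈ ∑[ i ≤ n ] (f i * x)
  *-distribʳ-∑ n x f = begin
    ∑ n f * x            ≈⟨ *-comm _ x ⟩
    x * ∑ n f            ≈⟨ *-distribˡ-∑ n x f ⟩
    ∑[ i ≤ n ] (x * f i) ≈⟨ ∑-cong n (λ i → *-comm x (f i)) ⟩
    ∑[ i ≤ n ] (f i * x) ∎

  ∑-last : ∀ n (f : ℕ → Carrier) → ∑ (suc n) f ≈ ∑ n f + f (suc n)
  ∑-last zero f = begin
    f 0 + (f 1 + 0#) ≈⟨ +-congˡ (+-comm (f 1) 0#) ⟩
    f 0 + (0# + f 1) ≈⟨ +-assoc _ _ _ ⟨
    (f 0 + 0#) + f 1 ∎
  ∑-last (suc n) f = begin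
    f 0 + ∑ (suc n) (λ i → f (suc i))               ≈⟨ +-congˡ (∑-last n (λ i → f (suc i))) ⟩
    f 0 + (∑ n (λ i → f (suc i)) + f (suc (suc n))) ≈⟨ +-assoc _ _ _ ⟨
    (f 0 + ∑ n (λ i → f (suc i))) + f (suc (suc n)) ∎

  ∑-reverse : ∀ n (f : ℕ → Carrier) → ∑ n f ≈ ∑[ i ≤ n ] f (n ∸ i)
  ∑-reverse zero f = refl
  ∑-reverse (suc n) f = begin
    f 0 + ∑[ i ≤ n ] f (suc i)
      ≈⟨ +-congˡ (∑-reverse n (λ i → f (suc i))) ⟩
    f 0 + ∑[ i ≤ n ] f (suc (n ∸ i))
      ≈⟨ +-comm _ _ ⟩
    ∑[ i ≤ n ] f (suc (n ∸ i)) + f 0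
      ≈⟨ +-cong (∑-cong≤ n λ i i≤n → reflexive (≡.cong f (≡.sym (ℕₚ.+-∸-assoc 1 i≤n))))
                (reflexive (≡.cong f (≡.sym (ℕₚ.n∸n≡0 n)))) ⟩
    ∑[ i ≤ n ] f (suc n ∸ i) + f (suc n ∸ suc n)
      ≈⟨ ∑-last n (λ i → f (suc n ∸ i)) ⟨
    ∑[ i ≤ suc n ] f (suc n ∸ i) ∎

  ∑-comm : ∀ n m (f : ℕ → ℕ → Carrier) → ∑[ i ≤ n ] ∑[ j ≤ m ] f i j ≈ ∑[ j ≤ m ] ∑[ i ≤ n ] f i j
  ∑-comm zero m f = begin
    ∑ m (f 0) + 0#                ≈⟨ +-congˡ (∑-zero m (λ _ _ → refl)) ⟨
    ∑ m (f 0) + ∑[ _ ≤ m ] 0#     ≈⟨ ∑-distrib-+ m _ _ ⟨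
    ∑[ j ≤ m ] (f 0 j + 0#)       ∎
  ∑-comm (suc n) m f = begin
    ∑ m (f 0) + ∑[ i ≤ n ] ∑[ j ≤ m ] f (suc i) j ≈⟨ +-congˡ (∑-comm n m (λ i j → f (suc i) j)) ⟩
    ∑ m (f 0) + ∑[ j ≤ m ] ∑[ i ≤ n ] f (suc i) j ≈⟨ ∑-distrib-+ m _ _ ⟨
    ∑[ j ≤ m ] (f 0 j + ∑[ i ≤ n ] f (suc i) j)   ∎

  ∑-triangle : ∀ n (f : ℕ → ℕ → Carrier) →
    ∑[ i ≤ n ] ∑[ j ≤ n ∸ i ] f i j ≈ ∑[ k ≤ n ] ∑[ i ≤ k ] f i (k ∸ i)
  ∑-triangle zero f = refl
  ∑-triangle (suc n) f = begin
    ∑[ i ≤ suc n ] ∑ (suc n ∸ i) (f i)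
      ≈⟨ ∑-last n _ ⟩
    ∑[ i ≤ n ] ∑ (suc n ∸ i) (f i) + ∑ (n ∸ n) (f (suc n))
      ≈⟨ +-cong (∑-cong≤ n peel) (reflexive (≡.cong (λ k → ∑ k (f (suc n))) (ℕₚ.n∸n≡0 n))) ⟩
    ∑[ i ≤ n ] (∑ (n ∸ i) (f i) + f i (suc n ∸ i)) + (f (suc n) 0 + 0#)
      ≈⟨ +-congʳ (∑-distrib-+ n _ _) ⟩
    (∑[ i ≤ n ] ∑ (n ∸ i) (f i) + ∑[ i ≤ n ] f i (suc n ∸ i)) + (f (suc n) 0 + 0#)
      ≈⟨ +-assoc _ _ _ ⟩
    ∑[ i ≤ n ] ∑ (n ∸ i) (f i) + (∑[ i ≤ n ] f i (suc n ∸ i) + (f (suc n) 0 + 0#))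
      ≈⟨ +-cong (∑-triangle n f)
                (+-congˡ (trans (+-identityʳ _) (reflexive (≡.cong (f (suc n)) (≡.sym (ℕₚ.n∸n≡0 n)))))) ⟩
    ∑[ k ≤ n ] ∑[ i ≤ k ] f i (k ∸ i) + (∑[ i ≤ n ] f i (suc n ∸ i) + f (suc n) (suc n ∸ suc n))
      ≈⟨ +-congˡ (∑-last n _) ⟨
    ∑[ k ≤ n ] ∑[ i ≤ k ] f i (k ∸ i) + ∑[ i ≤ suc n ] f i (suc n ∸ i)
      ≈⟨ ∑-last n _ ⟨
    ∑[ k ≤ suc n ] ∑[ i ≤ k ] f i (k ∸ i) ∎
    where
    peel : ∀ i → i ≤ n → ∑ (suc n ∸ i) (f i) ≈ ∑ (n ∸ i) (f i) + f i (suc n ∸ i)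
    peel i i≤n rewrite ℕₚ.+-∸-assoc 1 i≤n = ∑-last (n ∸ i) (f i)

  ∑-extend : ∀ {a N} (f : ℕ → Carrier) → a ≤ N → (∀ k → a < k → f k ≈ 0#) → ∑ a f ≈ ∑ N f
  ∑-extend {a} f a≤N f≈0 = extend (ℕₚ.≤⇒≤′ a≤N)
    where
    extend : ∀ {N} → a ℕ.≤′ N → ∑ a f ≈ ∑ N f
    extend ℕ.≤′-refl = refl
    extend (ℕ.≤′-step {N} a≤′N) = begin
      ∑ a f               ≈⟨ extend a≤′N ⟩
      ∑ N f               ≈⟨ +-identityʳ _ ⟨
      ∑ N f + 0#          ≈⟨ +-congˡ (f≈0 (suc N) (s≤s (ℕₚ.≤′⇒≤ a≤′N))) ⟨
      ∑ N f + f (suc N)   ≈⟨ ∑-last N f ⟨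
      ∑ (suc N) f         ∎

  ·-distrib-∑ : ∀ a n (f : ℕ → Carrier) → a · ∑ n f ≈ ∑[ i ≤ n ] (a · f i)
  ·-distrib-∑ a n f = begin
    a · ∑ n f                   ≈⟨ ·≈·1#* a (∑ n f) ⟩
    (a · 1#) * ∑ n f            ≈⟨ *-distribˡ-∑ n (a · 1#) f ⟩
    ∑[ i ≤ n ] ((a · 1#) * f i) ≈⟨ ∑-cong n (λ i → ·≈·1#* a (f i)) ⟨
    ∑[ i ≤ n ] (a · f i)        ∎
    where
    ·≈·1#* : ∀ a x → a · x ≈ (a · 1#) * x
    ·≈·1#* a x = trans (×-congʳ a (sym (*-identityˡ x))) (sym (×-assoc-* a 1# x))

  Ser : Set c
  Ser = ℕ → Carrier

  infix 4 _≈ₛ_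
  _≈ₛ_ : Ser → Ser → Set ℓ
  f ≈ₛ g = ∀ n → f n ≈ g n

  infixl 6 _+ₛ_
  _+ₛ_ : Ser → Ser → Ser
  (f +ₛ g) n = f n + g n

  infixl 7 _*ₛ_
  _*ₛ_ : Ser → Ser → Ser
  (f *ₛ g) n = ∑[ i ≤ n ] (f i * g (n ∸ i))

  0ₛ : Ser
  0ₛ _ = 0#

  1ₛ : Ser
  1ₛ zero    = 1#
  1ₛ (suc _) = 0#

  *ₛ-cong : ∀ {f f′ g g′} → f ≈ₛ f′ → g ≈ₛ g′ → f *ₛ g ≈ₛ f′ *ₛ g′
  *ₛ-cong f≈f′ g≈g′ n = ∑-cong n (λ i → *-cong (f≈f′ i) (g≈g′ (n ∸ i)))

  *ₛ-congˡ-below : ∀ {n} f {g g′} → (∀ i → i ≤ n → g i ≈ g′ i) → (f *ₛ g) n ≈ (f *ₛ g′) n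
  *ₛ-congˡ-below {n} f g≈g′ = ∑-cong≤ n (λ i i≤n → *-congˡ (g≈g′ (n ∸ i) (ℕₚ.m∸n≤m n i)))

  *ₛ-comm : ∀ f g → f *ₛ g ≈ₛ g *ₛ f
  *ₛ-comm f g n = begin
    ∑[ i ≤ n ] (f i * g (n ∸ i))             ≈⟨ ∑-reverse n _ ⟩
    ∑[ i ≤ n ] (f (n ∸ i) * g (n ∸ (n ∸ i))) ≈⟨ ∑-cong≤ n swap ⟩
    ∑[ i ≤ n ] (g i * f (n ∸ i))             ∎
    where
    swap : ∀ i → i ≤ n → f (n ∸ i) * g (n ∸ (n ∸ i)) ≈ g i * f (n ∸ i)
    swap i i≤n rewrite ℕₚ.m∸[m∸n]≡n i≤n = *-comm _ _

  *ₛ-assoc : ∀ f g h → (f *ₛ g) *ₛ h ≈ₛ f *ₛ (g *ₛ h)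
  *ₛ-assoc f g h n = begin
    ∑[ k ≤ n ] (∑[ i ≤ k ] (f i * g (k ∸ i)) * h (n ∸ k))
      ≈⟨ ∑-cong n (λ k → *-distribʳ-∑ k _ _) ⟩
    ∑[ k ≤ n ] ∑[ i ≤ k ] ((f i * g (k ∸ i)) * h (n ∸ k))
      ≈⟨ ∑-cong≤ n (λ k k≤n → ∑-cong≤ k (λ i i≤k → reassoc k i k≤n i≤k)) ⟩
    ∑[ k ≤ n ] ∑[ i ≤ k ] t i (k ∸ i)
      ≈⟨ ∑-triangle n t ⟨
    ∑[ i ≤ n ] ∑[ j ≤ n ∸ i ] t i j
      ≈⟨ ∑-cong n (λ i → *-distribˡ-∑ (n ∸ i) (f i) _) ⟨
    ∑[ i ≤ n ] (f i * ∑[ j ≤ n ∸ i ] (g j * h (n ∸ i ∸ j))) ∎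
    where
    t : ℕ → ℕ → Carrier
    t i j = f i * (g j * h (n ∸ i ∸ j))
    reassoc : ∀ k i → k ≤ n → i ≤ k → (f i * g (k ∸ i)) * h (n ∸ k) ≈ t i (k ∸ i)
    reassoc k i k≤n i≤k rewrite ℕₚ.∸-+-assoc n i (k ∸ i) | ℕₚ.m+[n∸m]≡n i≤k = *-assoc _ _ _

  *ₛ-identityˡ : ∀ f → 1ₛ *ₛ f ≈ₛ f
  *ₛ-identityˡ f zero    = trans (+-identityʳ _) (*-identityˡ _)
  *ₛ-identityˡ f (suc n) = begin
    1# * f (suc n) + ∑[ i ≤ n ] (0# * f (n ∸ i)) ≈⟨ +-cong (*-identityˡ _) (∑-zero n (λ i _ → zeroˡ _)) ⟩
    f (suc n) + 0#                              ≈⟨ +-identityʳ _ ⟩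
    f (suc n)                                   ∎

  commutativeSemiring : CommutativeSemiring c ℓ
  commutativeSemiring = record
    { Carrier = Ser ; _≈_ = _≈ₛ_ ; _+_ = _+ₛ_ ; _*_ = _*ₛ_ ; 0# = 0ₛ ; 1# = 1ₛ
    ; isCommutativeSemiring = IsCommutativeSemiringˡ.isCommutativeSemiring record
      { +-isCommutativeMonoid = record
        { isMonoid = record
          { isSemigroup = record
            { isMagma = record { isEquivalence = ≈ₛ-isEquivalence ; ∙-cong = λ p q n → +-cong (p n) (q n) }
            ; assoc = λ f g h n → +-assoc (f n) (g n) (h n) }
          ; identity = (λ f n → +-identityˡ (f n)) , (λ f n → +-identityʳ (f n)) }
        ; comm = λ f g n → +-comm (f n) (g n) }
      ; *-isCommutativeMonoid = record
        { isMonoid = record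
          { isSemigroup = record
            { isMagma = record { isEquivalence = ≈ₛ-isEquivalence ; ∙-cong = *ₛ-cong }
            ; assoc = *ₛ-assoc }
          ; identity = *ₛ-identityˡ , (λ f n → trans (*ₛ-comm f 1ₛ n) (*ₛ-identityˡ f n)) }
        ; comm = *ₛ-comm }
      ; distribʳ = λ h f g n → trans (∑-cong n (λ i → distribʳ _ _ _)) (∑-distrib-+ n _ _)
      ; zeroˡ = λ f n → ∑-zero n (λ i _ → zeroˡ _)
      }
    }
    where
    ≈ₛ-isEquivalence : IsEquivalence _≈ₛ_
    ≈ₛ-isEquivalence = record { refl = λ _ → refl ; sym = λ p n → sym (p n) ; trans = λ p q n → trans (p n) (q n) }

  open import Algebra.Definitions.RawSemiring (CommutativeSemiring.rawSemiring commutativeSemiring)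
    using () renaming (_^_ to _^ₛ_) public

  infixr 8 _·ₛ_
  _·ₛ_ : ℕ → Ser → Ser
  (a ·ₛ f) n = a · f n

  *ₛ-·ₛ : ∀ a f g → f *ₛ (a ·ₛ g) ≈ₛ a ·ₛ (f *ₛ g)
  *ₛ-·ₛ a f g n = begin
    ∑[ i ≤ n ] (f i * (a · g (n ∸ i))) ≈⟨ ∑-cong n (λ i → ×-comm-* a (f i) (g (n ∸ i))) ⟩
    ∑[ i ≤ n ] (a · (f i * g (n ∸ i))) ≈⟨ ·-distrib-∑ a n _ ⟨
    a · (f *ₛ g) n                     ∎

  ∂ : Ser → Ser
  ∂ f n = suc n · f (suc n)

  ∂-1ₛ : ∂ 1ₛ ≈ₛ 0ₛ
  ∂-1ₛ n = ·-zero (suc n)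
    where
    ·-zero : ∀ a → a · 0# ≈ 0#
    ·-zero zero    = refl
    ·-zero (suc a) = trans (+-identityˡ _) (·-zero a)

  ∂-*ₛ : ∀ f g → ∂ (f *ₛ g) ≈ₛ ∂ f *ₛ g +ₛ f *ₛ ∂ g
  ∂-*ₛ f g n = begin
    suc n · ∑ (suc n) h
      ≈⟨ ·-distrib-∑ (suc n) (suc n) h ⟩
    ∑[ i ≤ suc n ] (suc n · h i)
      ≈⟨ ∑-cong≤ (suc n) split ⟩
    ∑[ i ≤ suc n ] (i · h i + (suc n ∸ i) · h i)
      ≈⟨ ∑-distrib-+ (suc n) (λ i → i · h i) (λ i → (suc n ∸ i) · h i) ⟩
    ∑[ i ≤ suc n ] (i · h i) + ∑[ i ≤ suc n ] ((suc n ∸ i) · h i)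
      ≈⟨ +-cong left right ⟩
    (∂ f *ₛ g) n + (f *ₛ ∂ g) n ∎
    where
    h : ℕ → Carrier
    h i = f i * g (suc n ∸ i)
    split : ∀ i → i ≤ suc n → suc n · h i ≈ i · h i + (suc n ∸ i) · h i
    split i i≤ = trans (reflexive (≡.cong (_· h i) (≡.sym (ℕₚ.m+[n∸m]≡n i≤)))) (×-homo-+ (h i) i (suc n ∸ i))
    left : ∑[ i ≤ suc n ] (i · h i) ≈ (∂ f *ₛ g) n
    left = trans (+-identityˡ _) (∑-cong n (λ i → sym (×-assoc-* (suc i) _ _)))
    right : ∑[ i ≤ suc n ] ((suc n ∸ i) · h i) ≈ (f *ₛ ∂ g) n
    right = begin
      ∑[ i ≤ suc n ] ((suc n ∸ i) · h i)
        ≈⟨ ∑-last n _ ⟩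
      ∑[ i ≤ n ] ((suc n ∸ i) · h i) + (n ∸ n) · _
        ≈⟨ +-congˡ (reflexive (≡.cong (_· h (suc n)) (ℕₚ.n∸n≡0 n))) ⟩
      ∑[ i ≤ n ] ((suc n ∸ i) · h i) + 0#
        ≈⟨ +-identityʳ _ ⟩
      ∑[ i ≤ n ] ((suc n ∸ i) · h i)
        ≈⟨ ∑-cong≤ n shift ⟩
      (f *ₛ ∂ g) n ∎
      where
      shift : ∀ i → i ≤ n → (suc n ∸ i) · h i ≈ f i * ∂ g (n ∸ i)
      shift i i≤n rewrite ℕₚ.+-∸-assoc 1 i≤n = sym (×-comm-* (suc (n ∸ i)) (f i) _)

  ∂-^ₛ : ∀ f k → ∂ (f ^ₛ suc k) ≈ₛ suc k ·ₛ (∂ f *ₛ f ^ₛ k)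
  ∂-^ₛ f zero n = begin
    ∂ (f *ₛ 1ₛ) n                    ≈⟨ ∂-*ₛ f 1ₛ n ⟩
    (∂ f *ₛ 1ₛ) n + (f *ₛ ∂ 1ₛ) n    ≈⟨ +-congˡ (trans (*ₛ-cong {f} (λ _ → refl) ∂-1ₛ n) (S.zeroʳ f n)) ⟩
    (∂ f *ₛ 1ₛ) n + 0#               ∎
    where module S = CommutativeSemiring commutativeSemiring
  ∂-^ₛ f (suc k) n = begin
    ∂ (f *ₛ f ^ₛ suc k) n
      ≈⟨ ∂-*ₛ f (f ^ₛ suc k) n ⟩
    (∂ f *ₛ f ^ₛ suc k) n + (f *ₛ ∂ (f ^ₛ suc k)) n
      ≈⟨ +-congˡ (*ₛ-cong {f} (λ _ → refl) (∂-^ₛ f k) n) ⟩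
    (∂ f *ₛ f ^ₛ suc k) n + (f *ₛ (suc k ·ₛ p)) n
      ≈⟨ +-congˡ (*ₛ-·ₛ (suc k) f p n) ⟩
    (∂ f *ₛ f ^ₛ suc k) n + suc k · (f *ₛ p) n
      ≈⟨ +-congˡ (×-congʳ (suc k) (rotate n)) ⟩
    (∂ f *ₛ f ^ₛ suc k) n + suc k · (∂ f *ₛ f ^ₛ suc k) n ∎
    where
    p : Ser
    p = ∂ f *ₛ f ^ₛ k
    rotate : f *ₛ (∂ f *ₛ f ^ₛ k) ≈ₛ ∂ f *ₛ (f *ₛ f ^ₛ k)
    rotate n = begin
      (f *ₛ (∂ f *ₛ f ^ₛ k)) n ≈⟨ *ₛ-assoc f (∂ f) (f ^ₛ k) n ⟨
      ((f *ₛ ∂ f) *ₛ f ^ₛ k) n ≈⟨ *ₛ-cong {g = f ^ₛ k} (*ₛ-comm f (∂ f)) (λ _ → refl) n ⟩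
      ((∂ f *ₛ f) *ₛ f ^ₛ k) n ≈⟨ *ₛ-assoc (∂ f) f (f ^ₛ k) n ⟩
      (∂ f *ₛ (f *ₛ f ^ₛ k)) n ∎

  ^ₛ-vanishes-below : ∀ f → f 0 ≈ 0# → ∀ k n → n < k → (f ^ₛ k) n ≈ 0#
  ^ₛ-vanishes-below f f₀≈0 (suc k) n n<k = ∑-zero n term≈0
    where
    term≈0 : ∀ i → i ≤ n → f i * (f ^ₛ k) (n ∸ i) ≈ 0#
    term≈0 zero    _   = trans (*-congʳ f₀≈0) (zeroˡ _)
    term≈0 (suc i) i<n = trans (*-congˡ (^ₛ-vanishes-below f f₀≈0 k (n ∸ suc i) n∸i<k)) (zeroʳ _)
      where
      n∸i<k : n ∸ suc i < k
      n∸i<k = ℕₚ.<-≤-trans (ℕₚ.∸-monoʳ-< {n} {suc i} {0} (s≤s z≤n) i<n) (ℕₚ.≤-pred n<k)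

module ℕ⟦x⟧ = PowerSeries ℕₚ.+-*-commutativeSemiring
module ℚ⟦y⟧ = PowerSeries (CommutativeRing.commutativeSemiring ℚₚ.+-*-commutativeRing)
-- A Defs.Series F is the power series n ↦ F n in x over ℚ⟦y⟧.
module ℚ⟦y⟧⟦x⟧ = PowerSeries ℚ⟦y⟧.commutativeSemiring

module RationalArithmetic where

  open import Data.Nat as ℕ using (zero; suc; _!)
  open import Data.Nat.Properties using (_!≢0)
  import Data.Integer as ℤ
  import Data.Integer.Properties as ℤₚ
  open import Data.Rational using (1ℚ; _+_; _*_; toℚᵘ)
  import Data.Rational as ℚ
  open import Data.Rational.Properties
  import Data.Rational.Unnormalised as ℚᵘ
  import Data.Rational.Unnormalised.Properties as ℚᵘₚ
  open import Relation.Binary.PropositionalEquality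
  open import Algebra.Properties.Semiring.Mult (CommutativeRing.semiring +-*-commutativeRing)
    using (×-homo-+; ×1-homo-*) renaming (_×_ to _·_)

  fromℕ-suc : ∀ k → fromℕ (suc k) ≡ 1ℚ + fromℕ k
  fromℕ-suc k = toℚᵘ-injective (begin
    toℚᵘ (fromℕ (suc k))
      ≈⟨ toℚᵘ-fromℚᵘ (ℚᵘ.mkℚᵘ (ℤ.+ suc k) 0) ⟩
    ℚᵘ.mkℚᵘ (ℤ.+ suc k) 0
      ≈⟨ ℚᵘ.*≡* eq ⟩
    ℚᵘ.mkℚᵘ (ℤ.+ 1) 0 ℚᵘ.+ ℚᵘ.mkℚᵘ (ℤ.+ k) 0
      ≈⟨ ℚᵘₚ.+-cong (toℚᵘ-fromℚᵘ (ℚᵘ.mkℚᵘ (ℤ.+ 1) 0)) (toℚᵘ-fromℚᵘ (ℚᵘ.mkℚᵘ (ℤ.+ k) 0)) ⟨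
    toℚᵘ 1ℚ ℚᵘ.+ toℚᵘ (fromℕ k)
      ≈⟨ toℚᵘ-homo-+ 1ℚ (fromℕ k) ⟨
    toℚᵘ (1ℚ + fromℕ k) ∎)
    where
    open ℚᵘₚ.≃-Reasoning
    eq : ℤ.+ suc k ℤ.* (ℤ.+ 1 ℤ.* ℤ.+ 1) ≡ ((ℤ.+ 1 ℤ.* ℤ.+ 1) ℤ.+ (ℤ.+ k ℤ.* ℤ.+ 1)) ℤ.* ℤ.+ 1
    eq = trans (ℤₚ.*-identityʳ _) (sym (trans (ℤₚ.*-identityʳ _) (cong (ℤ._+_ (ℤ.+ 1)) (ℤₚ.*-identityʳ (ℤ.+ k)))))

  fromℕ≡·1ℚ : ∀ k → fromℕ k ≡ k · 1ℚ
  fromℕ≡·1ℚ zero    = refl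
  fromℕ≡·1ℚ (suc k) = trans (fromℕ-suc k) (cong (1ℚ +_) (fromℕ≡·1ℚ k))

  fromℕ-+ : ∀ a b → fromℕ (a ℕ.+ b) ≡ fromℕ a + fromℕ b
  fromℕ-+ a b = begin
    fromℕ (a ℕ.+ b)       ≡⟨ fromℕ≡·1ℚ (a ℕ.+ b) ⟩
    (a ℕ.+ b) · 1ℚ        ≡⟨ ×-homo-+ 1ℚ a b ⟩
    a · 1ℚ + b · 1ℚ       ≡⟨ cong₂ _+_ (fromℕ≡·1ℚ a) (fromℕ≡·1ℚ b) ⟨
    fromℕ a + fromℕ b     ∎
    where open ≡-Reasoning

  fromℕ-* : ∀ a b → fromℕ (a ℕ.* b) ≡ fromℕ a * fromℕ b
  fromℕ-* a b = begin
    fromℕ (a ℕ.* b)       ≡⟨ fromℕ≡·1ℚ (a ℕ.* b) ⟩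
    (a ℕ.* b) · 1ℚ        ≡⟨ ×1-homo-* a b ⟩
    (a · 1ℚ) * (b · 1ℚ)   ≡⟨ cong₂ _*_ (fromℕ≡·1ℚ a) (fromℕ≡·1ℚ b) ⟨
    fromℕ a * fromℕ b     ∎
    where open ≡-Reasoning

  fromℕ-*₃ : ∀ a b c → fromℕ (a ℕ.* (b ℕ.* c)) ≡ fromℕ a * (fromℕ b * fromℕ c)
  fromℕ-*₃ a b c = trans (fromℕ-* a (b ℕ.* c)) (cong (fromℕ a *_) (fromℕ-* b c))

  fromℕ-∑ : ∀ n f → fromℕ (ℕ⟦x⟧.∑ n f) ≡ ℚ⟦y⟧.∑ n (λ i → fromℕ (f i))
  fromℕ-∑ zero    f = fromℕ-+ (f 0) 0
  fromℕ-∑ (suc n) f = trans (fromℕ-+ (f 0) _) (cong (fromℕ (f 0) +_) (fromℕ-∑ n (λ i → f (suc i))))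

  x+y+z≡w⇒x≡w-z-y : ∀ {x y z w} → x + y + z ≡ w → x ≡ w ℚ.- z ℚ.- y
  x+y+z≡w⇒x≡w-z-y {x} {y} {z} refl =
    sym (trans (cong (ℚ._- y) (//-rightDividesʳ z (x + y))) (//-rightDividesʳ y x))
    where open import Algebra.Properties.Group +-0-group using (//-rightDividesʳ)

  inverse-unique : ∀ {p x y} → x * p ≡ 1ℚ → y * p ≡ 1ℚ → x ≡ y
  inverse-unique {p} {x} {y} xp≡1 yp≡1 = begin
    x             ≡⟨ *-identityʳ x ⟨
    x * 1ℚ        ≡⟨ cong (x *_) (trans (*-comm p y) yp≡1) ⟨
    x * (p * y)   ≡⟨ *-assoc x p y ⟨
    (x * p) * y   ≡⟨ cong (_* y) xp≡1 ⟩
    1ℚ * y        ≡⟨ *-identityˡ y ⟩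
    y             ∎
    where open ≡-Reasoning

  *-cancelˡ-invertible : ∀ {r p x y} → r * p ≡ 1ℚ → p * x ≡ p * y → x ≡ y
  *-cancelˡ-invertible {r} {p} {x} {y} rp≡1 px≡py = begin
    x             ≡⟨ *-identityˡ x ⟨
    1ℚ * x        ≡⟨ cong (_* x) rp≡1 ⟨
    (r * p) * x   ≡⟨ *-assoc r p x ⟩
    r * (p * x)   ≡⟨ cong (r *_) px≡py ⟩
    r * (p * y)   ≡⟨ *-assoc r p y ⟨
    (r * p) * y   ≡⟨ cong (_* y) rp≡1 ⟩
    1ℚ * y        ≡⟨ *-identityˡ y ⟩
    y             ∎
    where open ≡-Reasoning

  1/suc-inverse : ∀ d → ((ℤ.+ 1) ℚ./ suc d) * fromℕ (suc d) ≡ 1ℚ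
  1/suc-inverse d = toℚᵘ-injective (begin
    toℚᵘ ((ℤ.+ 1) ℚ./ suc d * fromℕ (suc d))
      ≈⟨ toℚᵘ-homo-* ((ℤ.+ 1) ℚ./ suc d) (fromℕ (suc d)) ⟩
    toℚᵘ ((ℤ.+ 1) ℚ./ suc d) ℚᵘ.* toℚᵘ (fromℕ (suc d))
      ≈⟨ ℚᵘₚ.*-cong (toℚᵘ-fromℚᵘ (ℚᵘ.mkℚᵘ (ℤ.+ 1) d)) (toℚᵘ-fromℚᵘ (ℚᵘ.mkℚᵘ (ℤ.+ suc d) 0)) ⟩
    ℚᵘ.mkℚᵘ (ℤ.+ 1) d ℚᵘ.* ℚᵘ.mkℚᵘ (ℤ.+ suc d) 0
      ≈⟨ ℚᵘ.*≡* eq ⟩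
    ℚᵘ.mkℚᵘ (ℤ.+ 1) 0
      ≈⟨ toℚᵘ-fromℚᵘ (ℚᵘ.mkℚᵘ (ℤ.+ 1) 0) ⟨
    toℚᵘ 1ℚ ∎)
    where
    open ℚᵘₚ.≃-Reasoning
    eq : ((ℤ.+ 1) ℤ.* (ℤ.+ suc d)) ℤ.* (ℤ.+ 1) ≡ (ℤ.+ 1) ℤ.* (ℤ.+ (suc d ℕ.* 1))
    eq = trans (ℤₚ.*-identityʳ _) (trans (ℤₚ.*-identityˡ _)
           (sym (trans (ℤₚ.*-identityˡ _) (cong ℤ.+_ (ℕₚ.*-identityʳ (suc d))))))

  fromℕ-suc-cancelˡ : ∀ n {x y} → fromℕ (suc n) * x ≡ fromℕ (suc n) * y → x ≡ y
  fromℕ-suc-cancelˡ n = *-cancelˡ-invertible {(ℤ.+ 1) ℚ./ suc n} {fromℕ (suc n)} (1/suc-inverse n)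

  inv!-inverse : ∀ k → inv! k * fromℕ (k !) ≡ 1ℚ
  inv!-inverse k = inverse-of-nonzero (k !) {{k !≢0}}
    where
    inverse-of-nonzero : ∀ d .{{_ : ℕ.NonZero d}} → ((ℤ.+ 1) ℚ./ d) * fromℕ d ≡ 1ℚ
    inverse-of-nonzero (suc d) = 1/suc-inverse d

  inv!-suc : ∀ k → inv! (suc k) * fromℕ (suc k) ≡ inv! k
  inv!-suc k = inverse-unique (begin
    inv! (suc k) * fromℕ (suc k) * fromℕ (k !)     ≡⟨ *-assoc (inv! (suc k)) _ _ ⟩
    inv! (suc k) * (fromℕ (suc k) * fromℕ (k !))   ≡⟨ cong (inv! (suc k) *_) (fromℕ-* (suc k) (k !)) ⟨
    inv! (suc k) * fromℕ (suc k !)                 ≡⟨ inv!-inverse (suc k) ⟩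
    1ℚ                                             ∎) (inv!-inverse k)
    where open ≡-Reasoning

module BivariateSeries where

  open import Data.Nat as ℕ using (zero; suc; _∸_)
  open import Data.List using (applyUpTo)
  open import Data.List.Properties using (map-upTo)
  open import Data.Rational using (ℚ; 1ℚ; _+_; _*_)
  open import Data.Rational.Properties
  open import Relation.Binary.PropositionalEquality
  open import Algebra.Properties.Semiring.Mult (CommutativeSemiring.semiring ℚ⟦y⟧.commutativeSemiring)
    using () renaming (_×_ to _·_)
  open RationalArithmetic
  open ℚ⟦y⟧ using (∑; ∑-cong)
  open ℚ⟦y⟧⟦x⟧ using (_*ₛ_; 1ₛ; _^ₛ_; ∂; *ₛ-cong; *ₛ-congˡ-below)
  open ≡-Reasoning

  Σ≤≡∑ : ∀ n f → Σ≤ n f ≡ ∑ n f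
  Σ≤≡∑ n f = trans (cong Σℚ (map-upTo f (suc n))) (sum-applyUpTo n f)
    where
    sum-applyUpTo : ∀ n (f : ℕ → ℚ) → Σℚ (applyUpTo f (suc n)) ≡ ∑ n f
    sum-applyUpTo zero    f = refl
    sum-applyUpTo (suc n) f = cong (f 0 +_) (sum-applyUpTo n (λ i → f (suc i)))

  ∑ₓ-at : ∀ n (H : ℕ → ℚ⟦y⟧.Ser) m → ℚ⟦y⟧⟦x⟧.∑ n H m ≡ ∑[ i ≤ n ] H i m
  ∑ₓ-at zero    H m = refl
  ∑ₓ-at (suc n) H m = cong (H 0 m +_) (∑ₓ-at n (λ i → H (suc i)) m)

  *ₛ-at : ∀ F G n m → (F *ₛ G) n m ≡ ∑[ i ≤ n ] ∑[ j ≤ m ] (F i j * G (n ∸ i) (m ∸ j))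
  *ₛ-at F G n = ∑ₓ-at n (λ i → F i ℚ⟦y⟧.*ₛ G (n ∸ i))

  ⊠≡*ₛ : ∀ F G n m → (F ⊠ G) n m ≡ (F *ₛ G) n m
  ⊠≡*ₛ F G n m = begin
    (F ⊠ G) n m                                            ≡⟨ Σ≤≡∑ n _ ⟩
    ∑[ i ≤ n ] Σ≤ m (λ j → F i j * G (n ∸ i) (m ∸ j))      ≡⟨ ∑-cong n (λ i → Σ≤≡∑ m _) ⟩
    ∑[ i ≤ n ] ∑[ j ≤ m ] (F i j * G (n ∸ i) (m ∸ j))      ≡⟨ *ₛ-at F G n m ⟨
    (F *ₛ G) n m                                           ∎

  oneS≡1ₛ : ∀ n m → oneS n m ≡ 1ₛ n m
  oneS≡1ₛ zero    zero    = refl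
  oneS≡1ₛ zero    (suc m) = refl
  oneS≡1ₛ (suc n) m       = refl

  ^S≡^ₛ : ∀ F k n m → (F ^S k) n m ≡ (F ^ₛ k) n m
  ^S≡^ₛ F zero    n m = oneS≡1ₛ n m
  ^S≡^ₛ F (suc k) n m = trans (⊠≡*ₛ F (F ^S k) n m) (*ₛ-cong {F} (λ _ _ → refl) (^S≡^ₛ F k) n m)

  ·-at : ∀ k (G : ℚ⟦y⟧.Ser) m → (k · G) m ≡ fromℕ k * G m
  ·-at zero    G m = sym (*-zeroˡ (G m))
  ·-at (suc k) G m = begin
    G m + (k · G) m               ≡⟨ cong (G m +_) (·-at k G m) ⟩
    G m + fromℕ k * G m           ≡⟨ cong (_+ fromℕ k * G m) (*-identityˡ (G m)) ⟨
    1ℚ * G m + fromℕ k * G m      ≡⟨ *-distribʳ-+ (G m) 1ℚ (fromℕ k) ⟨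
    (1ℚ + fromℕ k) * G m          ≡⟨ cong (_* G m) (fromℕ-suc k) ⟨
    fromℕ (suc k) * G m           ∎

  ∂x≡∂ : ∀ F n m → ∂x F n m ≡ ∂ F n m
  ∂x≡∂ F n m = sym (·-at (suc n) (F (suc n)) m)

  ⊠-congˡ-below : ∀ F {G H} n → (∀ a → a ℕ.≤ n → ∀ b → G a b ≡ H a b) →
                  ∀ m → (F ⊠ G) n m ≡ (F ⊠ H) n m
  ⊠-congˡ-below F {G} {H} n G≡H m = begin
    (F ⊠ G) n m   ≡⟨ ⊠≡*ₛ F G n m ⟩
    (F *ₛ G) n m  ≡⟨ *ₛ-congˡ-below F (λ a a≤n → G≡H a a≤n) m ⟩
    (F *ₛ H) n m  ≡⟨ ⊠≡*ₛ F H n m ⟨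
    (F ⊠ H) n m   ∎

module Exponential where

  open import Data.Nat as ℕ using (zero; suc; _∸_; _<_; s≤s)
  open import Data.Rational using (ℚ; 0ℚ; _+_; _*_)
  open import Data.Rational.Properties
  open import Relation.Binary.PropositionalEquality
  open Algebra.Properties.CommutativeSemigroup (CommutativeMonoid.commutativeSemigroup *-1-commutativeMonoid)
    using (x∙yz≈y∙xz)
  open import Algebra.Properties.Semiring.Mult (CommutativeSemiring.semiring ℚ⟦y⟧.commutativeSemiring)
    using () renaming (_×_ to _·_)
  open RationalArithmetic
  open ℚ⟦y⟧ using (∑; ∑-cong; ∑-comm; ∑-extend; *-distribˡ-∑)
  open ℚ⟦y⟧⟦x⟧ using (_*ₛ_; 1ₛ; _^ₛ_; ∂; ∂-1ₛ; ∂-^ₛ; *ₛ-cong; *ₛ-congˡ-below; ^ₛ-vanishes-below)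
  open BivariateSeries
  open ≡-Reasoning

  expS-zero : ∀ F m → expS F 0 m ≡ oneS 0 m
  expS-zero F m = trans (+-identityʳ _) (*-identityˡ _)

  expS-truncation : ∀ F → (∀ m → F 0 m ≡ 0ℚ) → ∀ {a N} → a ℕ.≤ N → ∀ b →
                    expS F a b ≡ ∑[ k ≤ N ] (inv! k * (F ^ₛ k) a b)
  expS-truncation F F₀≡0 {a} {N} a≤N b = begin
    expS F a b                              ≡⟨ Σ≤≡∑ a _ ⟩
    ∑[ k ≤ a ] (inv! k * (F ^S k) a b)      ≡⟨ ∑-cong a (λ k → cong (inv! k *_) (^S≡^ₛ F k a b)) ⟩
    ∑[ k ≤ a ] (inv! k * (F ^ₛ k) a b)      ≡⟨ ∑-extend _ a≤N high-powers-vanish ⟩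
    ∑[ k ≤ N ] (inv! k * (F ^ₛ k) a b)      ∎
    where
    high-powers-vanish : ∀ k → a < k → inv! k * (F ^ₛ k) a b ≡ 0ℚ
    high-powers-vanish k a<k = trans (cong (inv! k *_) (^ₛ-vanishes-below F F₀≡0 k a a<k b)) (*-zeroʳ (inv! k))

  ∂-exp-term : ∀ F k n m → inv! (suc k) * ∂ (F ^ₛ suc k) n m ≡ inv! k * (∂ F *ₛ F ^ₛ k) n m
  ∂-exp-term F k n m = begin
    inv! (suc k) * ∂ (F ^ₛ suc k) n m
      ≡⟨ cong (inv! (suc k) *_) (∂-^ₛ F k n m) ⟩
    inv! (suc k) * (suc k · (∂ F *ₛ F ^ₛ k) n) m
      ≡⟨ cong (inv! (suc k) *_) (·-at (suc k) ((∂ F *ₛ F ^ₛ k) n) m) ⟩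
    inv! (suc k) * (fromℕ (suc k) * (∂ F *ₛ F ^ₛ k) n m)
      ≡⟨ *-assoc (inv! (suc k)) (fromℕ (suc k)) _ ⟨
    inv! (suc k) * fromℕ (suc k) * (∂ F *ₛ F ^ₛ k) n m
      ≡⟨ cong (_* (∂ F *ₛ F ^ₛ k) n m) (inv!-suc k) ⟩
    inv! k * (∂ F *ₛ F ^ₛ k) n m ∎

  ∑-scaled-*ₛ : ∀ N (c : ℕ → ℚ) G (H : ℕ → Series) n m →
    ∑[ k ≤ N ] (c k * (G *ₛ H k) n m) ≡ (G *ₛ (λ a b → ∑[ k ≤ N ] (c k * H k a b))) n m
  ∑-scaled-*ₛ N c G H n m = begin
    ∑[ k ≤ N ] (c k * (G *ₛ H k) n m)
      ≡⟨ ∑-cong N (λ k → trans (cong (c k *_) (*ₛ-at G (H k) n m)) (*-distribˡ-∑ n (c k) _)) ⟩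
    ∑[ k ≤ N ] ∑[ i ≤ n ] (c k * ∑[ j ≤ m ] t k i j)
      ≡⟨ ∑-cong N (λ k → ∑-cong n (λ i → *-distribˡ-∑ m (c k) _)) ⟩
    ∑[ k ≤ N ] ∑[ i ≤ n ] ∑[ j ≤ m ] (c k * t k i j)
      ≡⟨ ∑-comm N n _ ⟩
    ∑[ i ≤ n ] ∑[ k ≤ N ] ∑[ j ≤ m ] (c k * t k i j)
      ≡⟨ ∑-cong n (λ i → ∑-comm N m _) ⟩
    ∑[ i ≤ n ] ∑[ j ≤ m ] ∑[ k ≤ N ] (c k * t k i j)
      ≡⟨ ∑-cong n (λ i → ∑-cong m (λ j → trans (*-distribˡ-∑ N (G i j) _)
                                               (∑-cong N (λ k → x∙yz≈y∙xz (G i j) (c k) _)))) ⟨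
    ∑[ i ≤ n ] ∑[ j ≤ m ] (G i j * ∑[ k ≤ N ] (c k * H k (n ∸ i) (m ∸ j)))
      ≡⟨ *ₛ-at G (λ a b → ∑[ k ≤ N ] (c k * H k a b)) n m ⟨
    (G *ₛ (λ a b → ∑[ k ≤ N ] (c k * H k a b))) n m ∎
    where
    t : ℕ → ℕ → ℕ → ℚ
    t k i j = G i j * H k (n ∸ i) (m ∸ j)

  ∂x-expS : ∀ F → (∀ m → F 0 m ≡ 0ℚ) → ∀ n m → ∂x (expS F) n m ≡ (∂x F ⊠ expS F) n m
  ∂x-expS F F₀≡0 n m = begin
    fromℕ (suc n) * expS F (suc n) m
      ≡⟨ cong (fromℕ (suc n) *_) (expS-truncation F F₀≡0 {suc n} ℕₚ.≤-refl m) ⟩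
    fromℕ (suc n) * ∑[ k ≤ suc n ] (inv! k * (F ^ₛ k) (suc n) m)
      ≡⟨ *-distribˡ-∑ (suc n) (fromℕ (suc n)) (λ k → inv! k * (F ^ₛ k) (suc n) m) ⟩
    ∑[ k ≤ suc n ] (fromℕ (suc n) * (inv! k * (F ^ₛ k) (suc n) m))
      ≡⟨ ∑-cong (suc n) (λ k → trans (x∙yz≈y∙xz (fromℕ (suc n)) (inv! k) ((F ^ₛ k) (suc n) m))
                                     (cong (inv! k *_) (∂x≡∂ (F ^ₛ k) n m))) ⟩
    inv! 0 * ∂ 1ₛ n m + ∑[ k ≤ n ] (inv! (suc k) * ∂ (F ^ₛ suc k) n m)
      ≡⟨ cong₂ _+_ (trans (cong (inv! 0 *_) (∂-1ₛ n m)) (*-zeroʳ (inv! 0))) (∑-cong n (λ k → ∂-exp-term F k n m)) ⟩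
    0ℚ + ∑[ k ≤ n ] (inv! k * (∂ F *ₛ F ^ₛ k) n m)
      ≡⟨ +-identityˡ _ ⟩
    ∑[ k ≤ n ] (inv! k * (∂ F *ₛ F ^ₛ k) n m)
      ≡⟨ ∑-scaled-*ₛ n inv! (∂ F) (F ^ₛ_) n m ⟩
    (∂ F *ₛ (λ a b → ∑[ k ≤ n ] (inv! k * (F ^ₛ k) a b))) n m
      ≡⟨ *ₛ-congˡ-below {n} (∂ F) {expS F} (λ a a≤n b → expS-truncation F F₀≡0 a≤n b) m ⟨
    (∂ F *ₛ expS F) n m
      ≡⟨ trans (⊠≡*ₛ (∂x F) (expS F) n m) (*ₛ-cong {g = expS F} (λ i j → ∂x≡∂ F i j) (λ _ _ → refl) n m) ⟨
    (∂x F ⊠ expS F) n m ∎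

  ode-unique : ∀ F G H → (∀ m → G 0 m ≡ H 0 m) →
               (∀ n m → ∂x G n m ≡ (∂x F ⊠ G) n m) → (∀ n m → ∂x H n m ≡ (∂x F ⊠ H) n m) →
               ∀ n m → G n m ≡ H n m
  ode-unique F G H G₀≡H₀ G′ H′ n = agree-below n n ℕₚ.≤-refl
    where
    agree-below : ∀ N n → n ℕ.≤ N → ∀ m → G n m ≡ H n m
    agree-below _       zero    _         = G₀≡H₀
    agree-below (suc N) (suc n) (s≤s n≤N) m = fromℕ-suc-cancelˡ n (begin
      fromℕ (suc n) * G (suc n) m
        ≡⟨ G′ n m ⟩
      (∂x F ⊠ G) n m
        ≡⟨ ⊠-congˡ-below (∂x F) n (λ a a≤n → agree-below N a (ℕₚ.≤-trans a≤n n≤N)) m ⟩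
      (∂x F ⊠ H) n m
        ≡⟨ H′ n m ⟨
      fromℕ (suc n) * H (suc n) m ∎)

module ExponentialGeneratingFunctions where

  open import Data.Nat as ℕ using (zero; suc; _∸_; _!)
  open import Data.Rational using (1ℚ; _+_; _*_)
  open import Data.Rational.Properties
  open import Relation.Binary.PropositionalEquality
  open Algebra.Properties.CommutativeSemigroup (CommutativeMonoid.commutativeSemigroup *-1-commutativeMonoid)
    using (interchange; x∙yz≈y∙xz; xy∙z≈y∙xz)
  open RationalArithmetic
  open ℚ⟦y⟧ using (∑; ∑-cong; ∑-cong≤; *-distribʳ-∑)
  open ℚ⟦y⟧⟦x⟧ using (_*ₛ_; *ₛ-cong)
  open BivariateSeries
  open Exponential
  open ≡-Reasoning

  shuffles : ℕ → ℕ → ℕ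
  shuffles zero    b       = 1
  shuffles (suc a) zero    = 1
  shuffles (suc a) (suc b) = shuffles a (suc b) ℕ.+ shuffles (suc a) b

  shuffles-*-! : ∀ a b → shuffles a b ℕ.* (a ! ℕ.* b !) ≡ (a ℕ.+ b) !
  shuffles-*-! zero    b    = trans (ℕₚ.+-identityʳ _) (ℕₚ.+-identityʳ (b !))
  shuffles-*-! (suc a) zero = trans (ℕₚ.+-identityʳ _) (trans (ℕₚ.*-identityʳ _) (cong _! (sym (ℕₚ.+-identityʳ (suc a)))))
  shuffles-*-! (suc a) (suc b) = begin
    (shuffles a (suc b) ℕ.+ shuffles (suc a) b) ℕ.* (suc a ! ℕ.* suc b !)
      ≡⟨ ℕₚ.*-distribʳ-+ (suc a ! ℕ.* suc b !) (shuffles a (suc b)) (shuffles (suc a) b) ⟩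
    shuffles a (suc b) ℕ.* (suc a ! ℕ.* suc b !) ℕ.+ shuffles (suc a) b ℕ.* (suc a ! ℕ.* suc b !)
      ≡⟨ cong₂ ℕ._+_ (trans (cong (shuffles a (suc b) ℕ.*_) (ℕₚ.*-assoc (suc a) (a !) (suc b !)))
                            (ℕ*.x∙yz≈y∙xz (shuffles a (suc b)) (suc a) (a ! ℕ.* suc b !)))
                     (trans (cong (shuffles (suc a) b ℕ.*_) (ℕ*.x∙yz≈y∙xz (suc a !) (suc b) (b !)))
                            (ℕ*.x∙yz≈y∙xz (shuffles (suc a) b) (suc b) (suc a ! ℕ.* b !))) ⟩
    suc a ℕ.* (shuffles a (suc b) ℕ.* (a ! ℕ.* suc b !)) ℕ.+ suc b ℕ.* (shuffles (suc a) b ℕ.* (suc a ! ℕ.* b !))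
      ≡⟨ cong₂ (λ x y → suc a ℕ.* x ℕ.+ suc b ℕ.* y) (shuffles-*-! a (suc b)) (shuffles-*-! (suc a) b) ⟩
    suc a ℕ.* (a ℕ.+ suc b) ! ℕ.+ suc b ℕ.* (suc a ℕ.+ b) !
      ≡⟨ cong (λ x → suc a ℕ.* (a ℕ.+ suc b) ! ℕ.+ suc b ℕ.* x !) (sym (ℕₚ.+-suc a b)) ⟩
    suc a ℕ.* (a ℕ.+ suc b) ! ℕ.+ suc b ℕ.* (a ℕ.+ suc b) !
      ≡⟨ ℕₚ.*-distribʳ-+ ((a ℕ.+ suc b) !) (suc a) (suc b) ⟨
    (suc a ℕ.+ suc b) ! ∎
    where
    module ℕ* = Algebra.Properties.CommutativeSemigroup ℕₚ.*-commutativeSemigroup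

  inv!-*-inv! : ∀ a b → inv! a * inv! b ≡ fromℕ (shuffles a b) * inv! (a ℕ.+ b)
  inv!-*-inv! a b = inverse-unique {p = fromℕ (a !) * fromℕ (b !)} product-inverse shuffled-inverse
    where
    product-inverse : inv! a * inv! b * (fromℕ (a !) * fromℕ (b !)) ≡ 1ℚ
    product-inverse = trans (interchange (inv! a) (inv! b) (fromℕ (a !)) (fromℕ (b !)))
                            (cong₂ _*_ (inv!-inverse a) (inv!-inverse b))
    shuffled-inverse : fromℕ (shuffles a b) * inv! (a ℕ.+ b) * (fromℕ (a !) * fromℕ (b !)) ≡ 1ℚ
    shuffled-inverse = begin
      fromℕ (shuffles a b) * inv! (a ℕ.+ b) * (fromℕ (a !) * fromℕ (b !))
        ≡⟨ xy∙z≈y∙xz (fromℕ (shuffles a b)) (inv! (a ℕ.+ b)) _ ⟩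
      inv! (a ℕ.+ b) * (fromℕ (shuffles a b) * (fromℕ (a !) * fromℕ (b !)))
        ≡⟨ cong (inv! (a ℕ.+ b) *_) (trans (sym (fromℕ-*₃ (shuffles a b) (a !) (b !))) (cong fromℕ (shuffles-*-! a b))) ⟩
      inv! (a ℕ.+ b) * fromℕ ((a ℕ.+ b) !)
        ≡⟨ inv!-inverse (a ℕ.+ b) ⟩
      1ℚ ∎

  egf : (ℕ → ℕ → ℕ) → Series
  egf c n m = fromℕ (c n m) * inv! n

  egf-+ : ∀ c d n m → egf (λ n m → c n m ℕ.+ d n m) n m ≡ egf c n m + egf d n m
  egf-+ c d n m = trans (cong (_* inv! n) (fromℕ-+ (c n m) (d n m))) (*-distribʳ-+ (inv! n) (fromℕ (c n m)) (fromℕ (d n m)))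

  ∂x-egf : ∀ c n m → ∂x (egf c) n m ≡ egf (λ n → c (suc n)) n m
  ∂x-egf c n m = begin
    fromℕ (suc n) * (fromℕ (c (suc n) m) * inv! (suc n))
      ≡⟨ x∙yz≈y∙xz (fromℕ (suc n)) (fromℕ (c (suc n) m)) _ ⟩
    fromℕ (c (suc n) m) * (fromℕ (suc n) * inv! (suc n))
      ≡⟨ cong (fromℕ (c (suc n) m) *_) (trans (*-comm (fromℕ (suc n)) _) (inv!-suc n)) ⟩
    fromℕ (c (suc n) m) * inv! n ∎

  -- Pairs of structures on complementary label sets; shuffles i k counts the ways to split the labels.
  labelledProduct : (ℕ → ℕ → ℕ) → (ℕ → ℕ → ℕ) → ℕ → ℕ → ℕ
  labelledProduct a c n m =
    ℕ⟦x⟧.∑ n (λ i → ℕ⟦x⟧.∑ m (λ j → shuffles i (n ∸ i) ℕ.* (a i j ℕ.* c (n ∸ i) (m ∸ j))))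

  egf-*-egf : ∀ a c i j k l → egf a i j * egf c k l ≡ fromℕ (shuffles i k ℕ.* (a i j ℕ.* c k l)) * inv! (i ℕ.+ k)
  egf-*-egf a c i j k l = begin
    fromℕ (a i j) * inv! i * (fromℕ (c k l) * inv! k)
      ≡⟨ interchange (fromℕ (a i j)) (inv! i) (fromℕ (c k l)) (inv! k) ⟩
    fromℕ (a i j) * fromℕ (c k l) * (inv! i * inv! k)
      ≡⟨ cong (fromℕ (a i j) * fromℕ (c k l) *_) (inv!-*-inv! i k) ⟩
    fromℕ (a i j) * fromℕ (c k l) * (fromℕ (shuffles i k) * inv! (i ℕ.+ k))
      ≡⟨ *-assoc (fromℕ (a i j) * fromℕ (c k l)) (fromℕ (shuffles i k)) _ ⟨
    fromℕ (a i j) * fromℕ (c k l) * fromℕ (shuffles i k) * inv! (i ℕ.+ k)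
      ≡⟨ cong (_* inv! (i ℕ.+ k)) (trans (*-comm (fromℕ (a i j) * fromℕ (c k l)) (fromℕ (shuffles i k)))
                                        (sym (fromℕ-*₃ (shuffles i k) (a i j) (c k l)))) ⟩
    fromℕ (shuffles i k ℕ.* (a i j ℕ.* c k l)) * inv! (i ℕ.+ k) ∎

  egf-⊠ : ∀ a c n m → (egf a ⊠ egf c) n m ≡ egf (labelledProduct a c) n m
  egf-⊠ a c n m = begin
    (egf a ⊠ egf c) n m
      ≡⟨ trans (⊠≡*ₛ (egf a) (egf c) n m) (*ₛ-at (egf a) (egf c) n m) ⟩
    ∑[ i ≤ n ] ∑[ j ≤ m ] (egf a i j * egf c (n ∸ i) (m ∸ j))
      ≡⟨ ∑-cong≤ n (λ i i≤n → ∑-cong m (λ j → term i j i≤n)) ⟩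
    ∑[ i ≤ n ] ∑[ j ≤ m ] (fromℕ (t i j) * inv! n)
      ≡⟨ ∑-cong n (λ i → *-distribʳ-∑ m (inv! n) _) ⟨
    ∑[ i ≤ n ] (∑[ j ≤ m ] fromℕ (t i j) * inv! n)
      ≡⟨ *-distribʳ-∑ n (inv! n) _ ⟨
    ∑[ i ≤ n ] ∑[ j ≤ m ] fromℕ (t i j) * inv! n
      ≡⟨ cong (_* inv! n) (∑-cong n (λ i → fromℕ-∑ m (t i))) ⟨
    ∑[ i ≤ n ] fromℕ (ℕ⟦x⟧.∑ m (t i)) * inv! n
      ≡⟨ cong (_* inv! n) (fromℕ-∑ n _) ⟨
    egf (labelledProduct a c) n m ∎
    where
    t : ℕ → ℕ → ℕ
    t i j = shuffles i (n ∸ i) ℕ.* (a i j ℕ.* c (n ∸ i) (m ∸ j))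
    term : ∀ i j → i ℕ.≤ n → egf a i j * egf c (n ∸ i) (m ∸ j) ≡ fromℕ (t i j) * inv! n
    term i j i≤n = trans (egf-*-egf a c i j (n ∸ i) (m ∸ j)) (cong (λ k → fromℕ (t i j) * inv! k) (ℕₚ.m+[n∸m]≡n i≤n))

  unit : ℕ → ℕ → ℕ
  unit zero zero = 1
  unit _    _    = 0

  oneS≡egf-unit : ∀ n m → oneS n m ≡ egf unit n m
  oneS≡egf-unit zero    zero    = refl
  oneS≡egf-unit zero    (suc m) = refl
  oneS≡egf-unit (suc n) m       = sym (*-zeroˡ (inv! (suc n)))

  -- b restricted to n, m ≥ 1, the only coefficients Bseries reads.
  positivePart : (ℕ → ℕ → ℕ) → ℕ → ℕ → ℕ
  positivePart b zero    _       = 0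
  positivePart b (suc n) zero    = 0
  positivePart b (suc n) (suc m) = b (suc n) (suc m)

  Bseries≡egf : ∀ b n m → Bseries b n m ≡ egf (positivePart b) n m
  Bseries≡egf b zero    m       = sym (*-zeroˡ (inv! 0))
  Bseries≡egf b (suc n) zero    = sym (*-zeroˡ (inv! (suc n)))
  Bseries≡egf b (suc n) (suc m) = refl

  y+1⊠ℕ : (ℕ → ℕ → ℕ) → ℕ → ℕ → ℕ
  y+1⊠ℕ c n zero    = c n zero
  y+1⊠ℕ c n (suc m) = c n (suc m) ℕ.+ c n m

  y+1⊠-egf : ∀ c n m → y+1⊠ (egf c) n m ≡ egf (y+1⊠ℕ c) n m
  y+1⊠-egf c n zero    = refl
  y+1⊠-egf c n (suc m) = sym (egf-+ (λ n m → c n (suc m)) c n m)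

  y+1⊠-cong : ∀ {F G} → (∀ n m → F n m ≡ G n m) → ∀ n m → y+1⊠ F n m ≡ y+1⊠ G n m
  y+1⊠-cong F≡G n zero    = F≡G n zero
  y+1⊠-cong F≡G n (suc m) = cong₂ _+_ (F≡G n (suc m)) (F≡G n m)

  module _ (b e : ℕ → ℕ → ℕ)
           (e-zero : ∀ m → e 0 m ≡ unit 0 m)
           (e-suc : ∀ n m → e (suc n) m ≡ labelledProduct (λ i → positivePart b (suc i)) e n m)
           (e-recolour : ∀ n m → positivePart b (suc n) m ℕ.+ unit n m ℕ.+ positivePart b n m ≡ y+1⊠ℕ e n m)
           where

    private
      B : Series
      B = Bseries b

      ∂x-Bseries : ∀ n m → ∂x B n m ≡ egf (λ n → positivePart b (suc n)) n m
      ∂x-Bseries n m = trans (cong (fromℕ (suc n) *_) (Bseries≡egf b (suc n) m)) (∂x-egf (positivePart b) n m)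

      egf-initial : ∀ m → egf e 0 m ≡ expS B 0 m
      egf-initial m = begin
        egf e 0 m      ≡⟨ cong (λ k → fromℕ k * inv! 0) (e-zero m) ⟩
        egf unit 0 m   ≡⟨ oneS≡egf-unit 0 m ⟨
        oneS 0 m       ≡⟨ expS-zero B m ⟨
        expS B 0 m     ∎

      egf-ode : ∀ n m → ∂x (egf e) n m ≡ (∂x B ⊠ egf e) n m
      egf-ode n m = begin
        ∂x (egf e) n m
          ≡⟨ ∂x-egf e n m ⟩
        egf (λ n → e (suc n)) n m
          ≡⟨ cong (λ k → fromℕ k * inv! n) (e-suc n m) ⟩
        egf (labelledProduct (λ i → positivePart b (suc i)) e) n m
          ≡⟨ egf-⊠ (λ i → positivePart b (suc i)) e n m ⟨
        (egf (λ i → positivePart b (suc i)) ⊠ egf e) n m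
          ≡⟨ ⊠≡*ₛ (egf (λ i → positivePart b (suc i))) (egf e) n m ⟩
        (egf (λ i → positivePart b (suc i)) *ₛ egf e) n m
          ≡⟨ *ₛ-cong {g = egf e} (λ i j → sym (∂x-Bseries i j)) (λ _ _ → refl) n m ⟩
        (∂x B *ₛ egf e) n m
          ≡⟨ ⊠≡*ₛ (∂x B) (egf e) n m ⟨
        (∂x B ⊠ egf e) n m ∎

      egf≡expS : ∀ n m → egf e n m ≡ expS B n m
      egf≡expS = ode-unique B (egf e) (expS B) egf-initial egf-ode (∂x-expS B (λ _ → refl))

      differential-identity : ∀ n m → ∂x B n m + oneS n m + B n m ≡ y+1⊠ (expS B) n m
      differential-identity n m = begin
        ∂x B n m + oneS n m + B n m
          ≡⟨ cong₂ _+_ (cong₂ _+_ (∂x-Bseries n m) (oneS≡egf-unit n m)) (Bseries≡egf b n m) ⟩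
        egf (λ n → positivePart b (suc n)) n m + egf unit n m + egf (positivePart b) n m
          ≡⟨ trans (egf-+ (λ n m → positivePart b (suc n) m ℕ.+ unit n m) (positivePart b) n m)
                   (cong (_+ egf (positivePart b) n m) (egf-+ (λ n → positivePart b (suc n)) unit n m)) ⟨
        egf (λ n m → positivePart b (suc n) m ℕ.+ unit n m ℕ.+ positivePart b n m) n m
          ≡⟨ cong (λ k → fromℕ k * inv! n) (e-recolour n m) ⟩
        egf (y+1⊠ℕ e) n m
          ≡⟨ y+1⊠-egf e n m ⟨
        y+1⊠ (egf e) n m
          ≡⟨ y+1⊠-cong egf≡expS n m ⟩
        y+1⊠ (expS B) n m ∎

    Bseries-ode : ∀ n m → ∂x B n m ≡ ((y+1⊠ (expS B) ⊟ B) ⊟ oneS) n m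
    Bseries-ode n m = x+y+z≡w⇒x≡w-z-y (differential-identity n m)

module Bijections where

  open import Data.Nat as ℕ using (zero; suc; _∸_)
  open import Data.Bool using (Bool; true; false)
  open import Data.Sum using (_⊎_; inj₁; inj₂)
  open import Data.Product using (Σ; _,_)
  open import Function.Bundles using (Inverse; mk↔ₛ′)
  open import Function.Properties.Inverse using (↔-refl; ↔-trans)
  open import Data.Sum.Algebra using (⊎-cong)
  open import Data.Fin.Properties using (+↔⊎)
  open import Data.Empty using (⊥-elim)
  open import Function.Base using (_∘_)
  open import Relation.Nullary using (¬_; Irrelevant)
  import Data.Bool.Properties
  import Axiom.UniquenessOfIdentityProofs as UIP
  open UIP using (module Decidable⇒UIP)
  open import Relation.Binary.PropositionalEquality

  empty↔ : ∀ {A B : Set} → ¬ A → ¬ B → A ↔ B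
  empty↔ ¬a ¬b = mk↔ₛ′ (⊥-elim ∘ ¬a) (⊥-elim ∘ ¬b) (⊥-elim ∘ ¬b) (⊥-elim ∘ ¬a)

  Σ-≡-irrelevant : ∀ {A : Set} {P : A → Set} → (∀ x → Irrelevant (P x)) →
                   ∀ {x y} {p : P x} {q : P y} → x ≡ y → _≡_ {A = Σ A P} (x , p) (y , q)
  Σ-≡-irrelevant P-irr {x} refl = cong (x ,_) (P-irr x _ _)

  Σ-↔-irrelevant : ∀ {A A′ : Set} {P : A → Set} {Q : A′ → Set} →
                   (∀ x → Irrelevant (P x)) → (∀ y → Irrelevant (Q y)) →
                   (f : A → A′) (g : A′ → A) → (∀ x → P x → Q (f x)) → (∀ y → Q y → P (g y)) →
                   (∀ y → Q y → f (g y) ≡ y) → (∀ x → P x → g (f x) ≡ x) →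
                   Σ A P ↔ Σ A′ Q
  Σ-↔-irrelevant P-irr Q-irr f g P⇒Q Q⇒P fg gf = mk↔ₛ′
    (λ (x , p) → f x , P⇒Q x p) (λ (y , q) → g y , Q⇒P y q)
    (λ (y , q) → Σ-≡-irrelevant Q-irr (fg y q)) (λ (x , p) → Σ-≡-irrelevant P-irr (gf x p))

  ×-irrelevant : ∀ {A B : Set} → Irrelevant A → Irrelevant B → Irrelevant (A × B)
  ×-irrelevant A-irr B-irr (a , b) (a′ , b′) = cong₂ _,_ (A-irr a a′) (B-irr b b′)

  Bool-≡-irrelevant : ∀ {x y : Bool} → Irrelevant (x ≡ y)
  Bool-≡-irrelevant = Decidable⇒UIP.≡-irrelevant Data.Bool.Properties._≟_

  Σ-split : ∀ {A : Set} {P : A → Set} (g : A → Bool) →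
            Σ A P ↔ (Σ A (λ x → P x × g x ≡ true) ⊎ Σ A (λ x → P x × g x ≡ false))
  Σ-split {A} {P} g = mk↔ₛ′ to from to-from from-to
    where
    Parts = Σ A (λ x → P x × g x ≡ true) ⊎ Σ A (λ x → P x × g x ≡ false)
    by-value : ∀ x → P x → ∀ c → g x ≡ c → Parts
    by-value x p true  gx≡c = inj₁ (x , p , gx≡c)
    by-value x p false gx≡c = inj₂ (x , p , gx≡c)
    to : Σ A P → Parts
    to (x , p) = by-value x p (g x) refl
    from : Parts → Σ A P
    from (inj₁ (x , p , _)) = x , p
    from (inj₂ (x , p , _)) = x , p
    by-value-true : ∀ x p c (e : g x ≡ c) (e′ : g x ≡ true) → by-value x p c e ≡ inj₁ (x , p , e′)
    by-value-true x p true  e e′ = cong (λ e → inj₁ (x , p , e)) (Bool-≡-irrelevant e e′)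
    by-value-true x p false e e′ with () ← trans (sym e) e′
    by-value-false : ∀ x p c (e : g x ≡ c) (e′ : g x ≡ false) → by-value x p c e ≡ inj₂ (x , p , e′)
    by-value-false x p false e e′ = cong (λ e → inj₂ (x , p , e)) (Bool-≡-irrelevant e e′)
    by-value-false x p true  e e′ with () ← trans (sym e) e′
    to-from : ∀ y → to (from y) ≡ y
    to-from (inj₁ (x , p , e)) = by-value-true x p (g x) refl e
    to-from (inj₂ (x , p , e)) = by-value-false x p (g x) refl e
    from-by-value : ∀ x p c (e : g x ≡ c) → from (by-value x p c e) ≡ (x , p)
    from-by-value x p true  e = refl
    from-by-value x p false e = refl
    from-to : ∀ x → from (to x) ≡ x
    from-to (x , p) = from-by-value x p (g x) refl

  Convolution : ℕ → (ℕ → ℕ → Set) → Set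
  Convolution n P = Σ ℕ λ a → Σ ℕ λ b → a ℕ.+ b ≡ n × P a b

  Fin-∑↔Convolution : ∀ n (h : ℕ → ℕ → ℕ) →
                      Fin (ℕ⟦x⟧.∑ n (λ a → h a (n ∸ a))) ↔ Convolution n (λ a b → Fin (h a b))
  Fin-∑↔Convolution zero h = ↔-trans +↔⊎ single-term
    where
    single-term : (Fin (h 0 0) ⊎ Fin 0) ↔ Convolution 0 (λ a b → Fin (h a b))
    single-term = mk↔ₛ′ (λ { (inj₁ x) → 0 , 0 , refl , x }) (λ { (0 , 0 , refl , x) → inj₁ x })
                        (λ { (0 , 0 , refl , x) → refl }) (λ { (inj₁ x) → refl })
  Fin-∑↔Convolution (suc n) h =
    ↔-trans +↔⊎ (↔-trans (⊎-cong ↔-refl (Fin-∑↔Convolution n (λ a b → h (suc a) b))) first-or-rest)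
    where
    first-or-rest : (Fin (h 0 (suc n)) ⊎ Convolution n (λ a b → Fin (h (suc a) b))) ↔ Convolution (suc n) (λ a b → Fin (h a b))
    first-or-rest = mk↔ₛ′
      (λ { (inj₁ x) → 0 , suc n , refl , x ; (inj₂ (a , b , eq , x)) → suc a , b , cong suc eq , x })
      (λ { (zero , b , refl , x) → inj₁ x ; (suc a , b , eq , x) → inj₂ (a , b , ℕₚ.suc-injective eq , x) })
      (λ { (zero , b , refl , x) → refl ; (suc a , b , eq , x) → cong (λ e → suc a , b , e , x) (ℕₚ.≡-irrelevant _ _) })
      (λ { (inj₁ x) → refl ; (inj₂ (a , b , eq , x)) → cong (λ e → inj₂ (a , b , e , x)) (ℕₚ.≡-irrelevant _ _) })

  Convolution-cong : ∀ {n} {P Q : ℕ → ℕ → Set} → (∀ a b → a ℕ.+ b ≡ n → P a b ↔ Q a b) →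
                     Convolution n P ↔ Convolution n Q
  Convolution-cong P↔Q = mk↔ₛ′
    (λ (a , b , eq , x) → a , b , eq , Inverse.to (P↔Q a b eq) x)
    (λ (a , b , eq , y) → a , b , eq , Inverse.from (P↔Q a b eq) y)
    (λ (a , b , eq , y) → cong (λ y → a , b , eq , y) (Inverse.strictlyInverseˡ (P↔Q a b eq) y))
    (λ (a , b , eq , x) → cong (λ x → a , b , eq , x) (Inverse.strictlyInverseʳ (P↔Q a b eq) x))

  Convolution-×ˡ : ∀ {m} {A : Set} {P : ℕ → ℕ → Set} → Convolution m (λ j k → A × P j k) ↔ (A × Convolution m P)
  Convolution-×ˡ = mk↔ₛ′ (λ (j , k , eq , x , p) → x , j , k , eq , p) (λ (x , j , k , eq , p) → j , k , eq , x , p)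
                         (λ _ → refl) (λ _ → refl)

module ColouredTrees where

  open import Data.Nat as ℕ using (zero; suc; _≤ᵇ_; z≤n; s≤s)
  open import Data.Fin as F using (zero; suc; inject₁)
  open import Data.Bool using (Bool; true; false; _∧_; _∨_)
  import Data.Bool.Properties
  open Data.Bool.Properties using (∧-identityˡ; ∧-identityʳ; ∧-assoc; ∧-conicalˡ; ∧-conicalʳ)
  open import Data.Sum using (_⊎_; inj₁; inj₂)
  import Data.Sum as Sum
  open import Data.Product using (Σ; _,_)
  open import Data.Empty using (⊥-elim)
  open import Relation.Binary.PropositionalEquality

  -- A coloured increasing tree grown one node at a time: grow t p c adds a node of colour c
  -- (true = blue) below p.  Fin index zero is the most recently added node and F.fromℕ n the root.
  data Tree : ℕ → Set where
    single : Bool → Tree 1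
    grow   : ∀ {n} → Tree (suc n) → Fin (suc n) → Bool → Tree (suc (suc n))

  infix 4 _==_
  _==_ : ∀ {n} → Fin n → Fin n → Bool
  zero  == zero  = true
  zero  == suc _ = false
  suc _ == zero  = false
  suc i == suc j = i == j

  bit : Bool → ℕ
  bit true  = 1
  bit false = 0

  degree : ∀ {n} → Tree n → Fin n → ℕ
  degree (single c)   zero    = 0
  degree (grow t p c) zero    = 0
  degree (grow t p c) (suc i) = degree t i ℕ.+ bit (p == i)

  colour : ∀ {n} → Tree n → Fin n → Bool
  colour (single c)   zero    = c
  colour (grow t p c) zero    = c
  colour (grow t p c) (suc i) = colour t i

  blueCount : ∀ {n} → Tree n → ℕ
  blueCount (single c)   = bit c
  blueCount (grow t p c) = bit c ℕ.+ blueCount t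

  rootColour : ∀ {n} → Tree n → Bool
  rootColour (single c)   = c
  rootColour (grow t p c) = rootColour t

  isRoot : ∀ {n} → Fin (suc n) → Bool
  isRoot {zero}  zero    = true
  isRoot {suc n} zero    = false
  isRoot {suc n} (suc i) = isRoot i

  rootDegree : ∀ {n} → Tree (suc n) → ℕ
  rootDegree {n} t = degree t (F.fromℕ n)

  allᵇ : ∀ {n} → (Fin n → Bool) → Bool
  allᵇ {zero}  f = true
  allᵇ {suc n} f = f zero ∧ allᵇ (λ i → f (suc i))

  validAt : ∀ {n} → Tree n → Fin n → Bool
  validAt t i = colour t i ∨ (2 ≤ᵇ degree t i)

  valid : ∀ {n} → Tree n → Bool
  valid t = allᵇ (validAt t)

  validBelowRoot : ∀ {n} → Tree (suc n) → Bool
  validBelowRoot t = allᵇ (λ i → isRoot i ∨ validAt t i)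

  allᵇ-cong : ∀ {n} {f g : Fin n → Bool} → (∀ i → f i ≡ g i) → allᵇ f ≡ allᵇ g
  allᵇ-cong {zero}  f≡g = refl
  allᵇ-cong {suc n} f≡g = cong₂ _∧_ (f≡g zero) (allᵇ-cong (λ i → f≡g (suc i)))

  allᵇ-sound : ∀ {n} (f : Fin n → Bool) → allᵇ f ≡ true → ∀ i → f i ≡ true
  allᵇ-sound f all≡true zero    = ∧-conicalˡ (f zero) _ all≡true
  allᵇ-sound f all≡true (suc i) = allᵇ-sound (λ i → f (suc i)) (∧-conicalʳ (f zero) _ all≡true) i

  allᵇ-complete : ∀ {n} (f : Fin n → Bool) → (∀ i → f i ≡ true) → allᵇ f ≡ true
  allᵇ-complete {zero}  f f≡true = refl
  allᵇ-complete {suc n} f f≡true rewrite f≡true zero = allᵇ-complete (λ i → f (suc i)) (λ i → f≡true (suc i))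

  allᵇ-last : ∀ {n} (f : Fin (suc n) → Bool) → allᵇ f ≡ allᵇ (λ i → f (inject₁ i)) ∧ f (F.fromℕ n)
  allᵇ-last {zero}  f = trans (∧-identityʳ (f zero)) (sym (∧-identityˡ (f zero)))
  allᵇ-last {suc n} f = trans (cong (f zero ∧_) (allᵇ-last (λ i → f (suc i)))) (sym (∧-assoc (f zero) _ _))

  allᵇ-root : ∀ {n} (f : Fin (suc n) → Bool) → allᵇ f ≡ allᵇ (λ i → isRoot i ∨ f i) ∧ f (F.fromℕ n)
  allᵇ-root {zero}  f = trans (∧-identityʳ (f zero)) (sym (∧-identityˡ (f zero)))
  allᵇ-root {suc n} f = trans (cong (f zero ∧_) (allᵇ-root (λ i → f (suc i)))) (sym (∧-assoc (f zero) _ _))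

  colour-root : ∀ {n} (t : Tree (suc n)) → colour t (F.fromℕ n) ≡ rootColour t
  colour-root (single c)   = refl
  colour-root (grow t p c) = colour-root t

  valid≡validBelowRoot∧root : ∀ {n} (t : Tree (suc n)) →
                              valid t ≡ validBelowRoot t ∧ (rootColour t ∨ (2 ≤ᵇ rootDegree t))
  valid≡validBelowRoot∧root t =
    trans (allᵇ-root (validAt t)) (cong (λ c → validBelowRoot t ∧ (c ∨ (2 ≤ᵇ rootDegree t))) (colour-root t))

  -- The newest node is a leaf, so in a valid tree it is blue.
  valid⇒blueCount≥1 : ∀ {n} (t : Tree (suc n)) → valid t ≡ true → 1 ℕ.≤ blueCount t
  valid⇒blueCount≥1 (single true)   _ = s≤s z≤n
  valid⇒blueCount≥1 (grow t p true) _ = s≤s z≤n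
  valid⇒blueCount≥1 (single false)   ()
  valid⇒blueCount≥1 (grow t p false) ()

  rootColour⇒blueCount≥1 : ∀ {n} (t : Tree (suc n)) → rootColour t ≡ true → Σ ℕ λ k → blueCount t ≡ suc k
  rootColour⇒blueCount≥1 (single true)  _ = 0 , refl
  rootColour⇒blueCount≥1 (grow t p c) root-blue with rootColour⇒blueCount≥1 t root-blue
  ... | k , blues≡1+k = bit c ℕ.+ k , trans (cong (bit c ℕ.+_) blues≡1+k) (ℕₚ.+-suc (bit c) k)

  -- Shuffle a b n interleaves the a + b = n non-root nodes of two trees, taken newest first.
  data Shuffle : ℕ → ℕ → ℕ → Set where
    []    : Shuffle 0 0 0
    left  : ∀ {a b n} → Shuffle a b n → Shuffle (suc a) b (suc n)
    right : ∀ {a b n} → Shuffle a b n → Shuffle a (suc b) (suc n)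

  shuffle-size : ∀ {a b n} → Shuffle a b n → a ℕ.+ b ≡ n
  shuffle-size []        = refl
  shuffle-size (left s)  = cong suc (shuffle-size s)
  shuffle-size {a} {suc b} (right s) = trans (ℕₚ.+-suc a b) (cong suc (shuffle-size s))

  place : ∀ {a b n} → Shuffle a b n → Fin (suc a) ⊎ Fin (suc b) → Fin (suc (suc n))
  place []        (inj₁ zero)    = zero
  place []        (inj₂ zero)    = suc zero
  place (left s)  (inj₁ zero)    = zero
  place (left s)  (inj₁ (suc i)) = suc (place s (inj₁ i))
  place (left s)  (inj₂ j)       = suc (place s (inj₂ j))
  place (right s) (inj₂ zero)    = zero
  place (right s) (inj₂ (suc j)) = suc (place s (inj₂ j))
  place (right s) (inj₁ i)       = suc (place s (inj₁ i))

  origin : ∀ {a b n} → Shuffle a b n → Fin (suc (suc n)) → Fin (suc a) ⊎ Fin (suc b)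
  origin []        zero       = inj₁ zero
  origin []        (suc zero) = inj₂ zero
  origin (left s)  zero       = inj₁ zero
  origin (left s)  (suc k)    = Sum.map₁ suc (origin s k)
  origin (right s) zero       = inj₂ zero
  origin (right s) (suc k)    = Sum.map₂ suc (origin s k)

  origin-place : ∀ {a b n} (s : Shuffle a b n) x → origin s (place s x) ≡ x
  origin-place []        (inj₁ zero)    = refl
  origin-place []        (inj₂ zero)    = refl
  origin-place (left s)  (inj₁ zero)    = refl
  origin-place (left s)  (inj₁ (suc i)) = cong (Sum.map₁ suc) (origin-place s (inj₁ i))
  origin-place (left s)  (inj₂ j)       = cong (Sum.map₁ suc) (origin-place s (inj₂ j))
  origin-place (right s) (inj₂ zero)    = refl
  origin-place (right s) (inj₂ (suc j)) = cong (Sum.map₂ suc) (origin-place s (inj₂ j))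
  origin-place (right s) (inj₁ i)       = cong (Sum.map₂ suc) (origin-place s (inj₁ i))

  place-origin : ∀ {a b n} (s : Shuffle a b n) k → place s (origin s k) ≡ k
  place-origin []        zero       = refl
  place-origin []        (suc zero) = refl
  place-origin (left s)  zero       = refl
  place-origin (left s)  (suc k)    = place-suc (origin s k) (place-origin s k)
    where
    place-suc : ∀ x → place s x ≡ k → place (left s) (Sum.map₁ suc x) ≡ suc k
    place-suc (inj₁ i) eq = cong suc eq
    place-suc (inj₂ j) eq = cong suc eq
  place-origin (right s) zero       = refl
  place-origin (right s) (suc k)    = place-suc (origin s k) (place-origin s k)
    where
    place-suc : ∀ x → place s x ≡ k → place (right s) (Sum.map₂ suc x) ≡ suc k
    place-suc (inj₁ i) eq = cong suc eq
    place-suc (inj₂ j) eq = cong suc eq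

  -- attach s L R hangs L below the root of R: node 0 is R's root, node 1 is L's root, and the
  -- remaining nodes of L and R are interleaved by s.
  attach : ∀ {a b n} → Shuffle a b n → Tree (suc a) → Tree (suc b) → Tree (suc (suc n))
  attach []        (single cL)  (single cR)  = grow (single cR) zero cL
  attach (left s)  (grow L p c) R            = grow (attach s L R) (place s (inj₁ p)) c
  attach (right s) L            (grow R p c) = grow (attach s L R) (place s (inj₂ p)) c

  Attachment : ℕ → Set
  Attachment n = Σ ℕ λ a → Σ ℕ λ b → Shuffle a b n × Tree (suc a) × Tree (suc b)

  attach′ : ∀ {n} → Attachment n → Tree (suc (suc n))
  attach′ (a , b , s , L , R) = attach s L R

  extend : ∀ {a b n} → Shuffle a b n → Tree (suc a) → Tree (suc b) → Bool →
           Fin (suc a) ⊎ Fin (suc b) → Attachment (suc n)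
  extend {a} {b} s L R c (inj₁ q) = suc a , b , left s , grow L q c , R
  extend {a} {b} s L R c (inj₂ q) = a , suc b , right s , L , grow R q c

  detach-grow : ∀ {n} → Attachment n → Fin (suc (suc n)) → Bool → Attachment (suc n)
  detach-grow (a , b , s , L , R) p c = extend s L R c (origin s p)

  detach : ∀ {n} → Tree (suc (suc n)) → Attachment n
  detach (grow (single cR) zero cL) = 0 , 0 , [] , single cL , single cR
  detach (grow (grow T q c′) p c)   = detach-grow (detach (grow T q c′)) p c

  detach-grow≡ : ∀ {n} (T : Tree (suc (suc n))) p c → detach (grow T p c) ≡ detach-grow (detach T) p c
  detach-grow≡ (grow T q c′) p c = refl

  attach′-detach-grow : ∀ {n} (d : Attachment n) p c → attach′ (detach-grow d p c) ≡ grow (attach′ d) p c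
  attach′-detach-grow (a , b , s , L , R) p c = attach-extend (origin s p) (place-origin s p)
    where
    attach-extend : ∀ x → place s x ≡ p → attach′ (extend s L R c x) ≡ grow (attach s L R) p c
    attach-extend (inj₁ q) refl = refl
    attach-extend (inj₂ q) refl = refl

  attach-detach : ∀ {n} (T : Tree (suc (suc n))) → attach′ (detach T) ≡ T
  attach-detach (grow (single cR) zero cL) = refl
  attach-detach (grow (grow T q c′) p c) =
    trans (attach′-detach-grow (detach (grow T q c′)) p c) (cong (λ T′ → grow T′ p c) (attach-detach (grow T q c′)))

  detach-attach : ∀ {a b n} (s : Shuffle a b n) L R → detach (attach s L R) ≡ (a , b , s , L , R)
  detach-attach []        (single cL)  (single cR) = refl
  detach-attach (left s)  (grow L q c) R
    rewrite detach-grow≡ (attach s L R) (place s (inj₁ q)) c | detach-attach s L R | origin-place s (inj₁ q) = refl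
  detach-attach (right s) L (grow R q c)
    rewrite detach-grow≡ (attach s L R) (place s (inj₂ q)) c | detach-attach s L R | origin-place s (inj₂ q) = refl

  blueCount-attach : ∀ {a b n} (s : Shuffle a b n) L R → blueCount (attach s L R) ≡ blueCount L ℕ.+ blueCount R
  blueCount-attach []        (single cL)  (single cR)  = refl
  blueCount-attach (left s)  (grow L q c) R            =
    trans (cong (bit c ℕ.+_) (blueCount-attach s L R)) (sym (ℕₚ.+-assoc (bit c) (blueCount L) (blueCount R)))
  blueCount-attach (right s) L            (grow R q c) =
    trans (cong (bit c ℕ.+_) (blueCount-attach s L R)) (ℕ+.x∙yz≈y∙xz (bit c) (blueCount L) (blueCount R))
    where module ℕ+ = Algebra.Properties.CommutativeSemigroup ℕₚ.+-commutativeSemigroup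

  rootColour-attach : ∀ {a b n} (s : Shuffle a b n) L R → rootColour (attach s L R) ≡ rootColour R
  rootColour-attach []        (single cL)  (single cR)  = refl
  rootColour-attach (left s)  (grow L q c) R            = rootColour-attach s L R
  rootColour-attach (right s) L            (grow R q c) = rootColour-attach s L R

  colour-attachˡ : ∀ {a b n} (s : Shuffle a b n) L R i → colour (attach s L R) (place s (inj₁ i)) ≡ colour L i
  colour-attachˡ []        (single cL)  (single cR)  zero    = refl
  colour-attachˡ (left s)  (grow L q c) R            zero    = refl
  colour-attachˡ (left s)  (grow L q c) R            (suc i) = colour-attachˡ s L R i
  colour-attachˡ (right s) L            (grow R q c) i       = colour-attachˡ s L R i

  colour-attachʳ : ∀ {a b n} (s : Shuffle a b n) L R j → colour (attach s L R) (place s (inj₂ j)) ≡ colour R j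
  colour-attachʳ []        (single cL)  (single cR)  zero    = refl
  colour-attachʳ (left s)  (grow L q c) R            j       = colour-attachʳ s L R j
  colour-attachʳ (right s) L            (grow R q c) zero    = refl
  colour-attachʳ (right s) L            (grow R q c) (suc j) = colour-attachʳ s L R j

  _==⊎_ : ∀ {a b} → Fin a ⊎ Fin b → Fin a ⊎ Fin b → Bool
  inj₁ x ==⊎ inj₁ y = x == y
  inj₂ x ==⊎ inj₂ y = x == y
  inj₁ x ==⊎ inj₂ y = false
  inj₂ x ==⊎ inj₁ y = false

  ==-place : ∀ {a b n} (s : Shuffle a b n) x y → (place s x == place s y) ≡ (x ==⊎ y)
  ==-place []        (inj₁ zero)    (inj₁ zero)    = refl
  ==-place []        (inj₁ zero)    (inj₂ zero)    = refl
  ==-place []        (inj₂ zero)    (inj₁ zero)    = refl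
  ==-place []        (inj₂ zero)    (inj₂ zero)    = refl
  ==-place (left s)  (inj₁ zero)    (inj₁ zero)    = refl
  ==-place (left s)  (inj₁ zero)    (inj₁ (suc y)) = refl
  ==-place (left s)  (inj₁ zero)    (inj₂ y)       = refl
  ==-place (left s)  (inj₁ (suc x)) (inj₁ zero)    = refl
  ==-place (left s)  (inj₁ (suc x)) (inj₁ (suc y)) = ==-place s (inj₁ x) (inj₁ y)
  ==-place (left s)  (inj₁ (suc x)) (inj₂ y)       = ==-place s (inj₁ x) (inj₂ y)
  ==-place (left s)  (inj₂ x)       (inj₁ zero)    = refl
  ==-place (left s)  (inj₂ x)       (inj₁ (suc y)) = ==-place s (inj₂ x) (inj₁ y)
  ==-place (left s)  (inj₂ x)       (inj₂ y)       = ==-place s (inj₂ x) (inj₂ y)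
  ==-place (right s) (inj₂ zero)    (inj₂ zero)    = refl
  ==-place (right s) (inj₂ zero)    (inj₂ (suc y)) = refl
  ==-place (right s) (inj₂ zero)    (inj₁ y)       = refl
  ==-place (right s) (inj₂ (suc x)) (inj₂ zero)    = refl
  ==-place (right s) (inj₂ (suc x)) (inj₂ (suc y)) = ==-place s (inj₂ x) (inj₂ y)
  ==-place (right s) (inj₂ (suc x)) (inj₁ y)       = ==-place s (inj₂ x) (inj₁ y)
  ==-place (right s) (inj₁ x)       (inj₂ zero)    = refl
  ==-place (right s) (inj₁ x)       (inj₂ (suc y)) = ==-place s (inj₁ x) (inj₂ y)
  ==-place (right s) (inj₁ x)       (inj₁ y)       = ==-place s (inj₁ x) (inj₁ y)

  degree-attachˡ : ∀ {a b n} (s : Shuffle a b n) L R i → degree (attach s L R) (place s (inj₁ i)) ≡ degree L i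
  degree-attachˡ []        (single cL)  (single cR)  zero    = refl
  degree-attachˡ (left s)  (grow L q c) R            zero    = refl
  degree-attachˡ (left s)  (grow L q c) R            (suc i) =
    cong₂ ℕ._+_ (degree-attachˡ s L R i) (cong bit (==-place s (inj₁ q) (inj₁ i)))
  degree-attachˡ (right s) L            (grow R q c) i       =
    trans (cong₂ ℕ._+_ (degree-attachˡ s L R i) (cong bit (==-place s (inj₂ q) (inj₁ i)))) (ℕₚ.+-identityʳ (degree L i))

  -- R's root gains L's root as an extra child.
  degree-attachʳ : ∀ {a b n} (s : Shuffle a b n) L R j →
                   degree (attach s L R) (place s (inj₂ j)) ≡ degree R j ℕ.+ bit (isRoot j)
  degree-attachʳ []        (single cL)  (single cR)  zero    = refl
  degree-attachʳ (left s)  (grow L q c) R            j       =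
    trans (cong₂ ℕ._+_ (degree-attachʳ s L R j) (cong bit (==-place s (inj₁ q) (inj₂ j)))) (ℕₚ.+-identityʳ _)
  degree-attachʳ (right s) L            (grow R q c) zero    = refl
  degree-attachʳ (right s) L            (grow R q c) (suc j) =
    trans (cong₂ ℕ._+_ (degree-attachʳ s L R j) (cong bit (==-place s (inj₂ q) (inj₂ j))))
          (ℕ+.xy∙z≈xz∙y (degree R j) (bit (isRoot j)) (bit (q == j)))
    where module ℕ+ = Algebra.Properties.CommutativeSemigroup ℕₚ.+-commutativeSemigroup

  isRoot-placeˡ : ∀ {a b n} (s : Shuffle a b n) i → isRoot (place s (inj₁ i)) ≡ false
  isRoot-placeˡ []        zero    = refl
  isRoot-placeˡ (left s)  zero    = refl
  isRoot-placeˡ (left s)  (suc i) = isRoot-placeˡ s i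
  isRoot-placeˡ (right s) i       = isRoot-placeˡ s i

  isRoot-placeʳ : ∀ {a b n} (s : Shuffle a b n) j → isRoot (place s (inj₂ j)) ≡ isRoot j
  isRoot-placeʳ []        zero    = refl
  isRoot-placeʳ (left s)  j       = isRoot-placeʳ s j
  isRoot-placeʳ {b = suc b} (right s) zero = refl
  isRoot-placeʳ (right s) (suc j) = isRoot-placeʳ s j

  allᵇ-place : ∀ {a b n} (s : Shuffle a b n) (f : Fin (suc (suc n)) → Bool) →
               allᵇ f ≡ allᵇ (λ i → f (place s (inj₁ i))) ∧ allᵇ (λ j → f (place s (inj₂ j)))
  allᵇ-place []        f = cong₂ _∧_ (sym (∧-identityʳ (f zero))) refl
  allᵇ-place (left s)  f = trans (cong (f zero ∧_) (allᵇ-place s (λ k → f (suc k)))) (sym (∧-assoc (f zero) _ _))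
  allᵇ-place (right s) f = trans (cong (f zero ∧_) (allᵇ-place s (λ k → f (suc k))))
                                 (∧.x∙yz≈y∙xz (f zero) (allᵇ (λ i → f (suc (place s (inj₁ i)))))
                                                       (allᵇ (λ j → f (suc (place s (inj₂ j))))))
    where
    module ∧ = Algebra.Properties.CommutativeSemigroup
                 (CommutativeMonoid.commutativeSemigroup Data.Bool.Properties.∧-commutativeMonoid)

  validBelowRoot-attach : ∀ {a b n} (s : Shuffle a b n) L R →
                          validBelowRoot (attach s L R) ≡ valid L ∧ validBelowRoot R
  validBelowRoot-attach s L R =
    trans (allᵇ-place s (λ k → isRoot k ∨ validAt T k)) (cong₂ _∧_ (allᵇ-cong fromL) (allᵇ-cong fromR))
    where
    T = attach s L R
    fromL : ∀ i → (isRoot (place s (inj₁ i)) ∨ validAt T (place s (inj₁ i))) ≡ validAt L i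
    fromL i rewrite isRoot-placeˡ s i | colour-attachˡ s L R i | degree-attachˡ s L R i = refl
    fromR : ∀ j → (isRoot (place s (inj₂ j)) ∨ validAt T (place s (inj₂ j))) ≡ (isRoot j ∨ validAt R j)
    fromR j rewrite isRoot-placeʳ s j | colour-attachʳ s L R j | degree-attachʳ s L R j with isRoot j
    ... | true  = refl
    ... | false = cong (λ d → colour R j ∨ (2 ≤ᵇ d)) (ℕₚ.+-identityʳ (degree R j))

  recolourRoot : ∀ {n} → Bool → Tree n → Tree n
  recolourRoot c (single _)   = single c
  recolourRoot c (grow t p d) = grow (recolourRoot c t) p d

  degree-recolourRoot : ∀ {n} c (t : Tree n) i → degree (recolourRoot c t) i ≡ degree t i
  degree-recolourRoot c (single _)   zero    = refl
  degree-recolourRoot c (grow t p d) zero    = refl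
  degree-recolourRoot c (grow t p d) (suc i) = cong (ℕ._+ bit (p == i)) (degree-recolourRoot c t i)

  colour-recolourRoot : ∀ {n} c (t : Tree (suc n)) i → isRoot i ≡ false → colour (recolourRoot c t) i ≡ colour t i
  colour-recolourRoot c (single _)   zero    ()
  colour-recolourRoot c (grow t p d) zero    _ = refl
  colour-recolourRoot c (grow t p d) (suc i) i≢root = colour-recolourRoot c t i i≢root

  rootColour-recolourRoot : ∀ {n} c (t : Tree n) → rootColour (recolourRoot c t) ≡ c
  rootColour-recolourRoot c (single _)   = refl
  rootColour-recolourRoot c (grow t p d) = rootColour-recolourRoot c t

  blueCount-recolourRoot-red : ∀ {n} (t : Tree n) → rootColour t ≡ true →
                               suc (blueCount (recolourRoot false t)) ≡ blueCount t
  blueCount-recolourRoot-red (single true)  _         = refl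
  blueCount-recolourRoot-red (grow t p d)   root-blue =
    trans (sym (ℕₚ.+-suc (bit d) _)) (cong (bit d ℕ.+_) (blueCount-recolourRoot-red t root-blue))

  blueCount-recolourRoot-blue : ∀ {n} (t : Tree n) → rootColour t ≡ false →
                                blueCount (recolourRoot true t) ≡ suc (blueCount t)
  blueCount-recolourRoot-blue (single false) _        = refl
  blueCount-recolourRoot-blue (grow t p d)   root-red =
    trans (cong (bit d ℕ.+_) (blueCount-recolourRoot-blue t root-red)) (ℕₚ.+-suc (bit d) _)

  validBelowRoot-recolourRoot : ∀ {n} c (t : Tree (suc n)) → validBelowRoot (recolourRoot c t) ≡ validBelowRoot t
  validBelowRoot-recolourRoot c t = allᵇ-cong same
    where
    same : ∀ i → (isRoot i ∨ validAt (recolourRoot c t) i) ≡ (isRoot i ∨ validAt t i)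
    same i with isRoot i in i-root
    ... | true  = refl
    ... | false = cong₂ (λ x d → x ∨ (2 ≤ᵇ d)) (colour-recolourRoot c t i i-root) (degree-recolourRoot c t i)

  recolourRoot-rootColour : ∀ {n} (t : Tree n) → recolourRoot (rootColour t) t ≡ t
  recolourRoot-rootColour (single c)   = refl
  recolourRoot-rootColour (grow t p d) = cong (λ t′ → grow t′ p d) (recolourRoot-rootColour t)

  recolourRoot-recolourRoot : ∀ {n} c c′ (t : Tree n) → recolourRoot c (recolourRoot c′ t) ≡ recolourRoot c t
  recolourRoot-recolourRoot c c′ (single _)   = refl
  recolourRoot-recolourRoot c c′ (grow t p d) = cong (λ t′ → grow t′ p d) (recolourRoot-recolourRoot c c′ t)

  ==-inject₁ : ∀ {n} (p i : Fin n) → (inject₁ p == inject₁ i) ≡ (p == i)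
  ==-inject₁ zero    zero    = refl
  ==-inject₁ zero    (suc i) = refl
  ==-inject₁ (suc p) zero    = refl
  ==-inject₁ (suc p) (suc i) = ==-inject₁ p i

  ==-root : ∀ {n} (p : Fin (suc n)) → (p == F.fromℕ n) ≡ isRoot p
  ==-root {zero}  zero    = refl
  ==-root {suc n} zero    = refl
  ==-root {suc n} (suc p) = ==-root p

  isRoot-inject₁ : ∀ {n} (i : Fin (suc n)) → isRoot (inject₁ i) ≡ false
  isRoot-inject₁ {zero}  zero    = refl
  isRoot-inject₁ {suc n} zero    = refl
  isRoot-inject₁ {suc n} (suc i) = isRoot-inject₁ i

  isRoot-fromℕ : ∀ n → isRoot (F.fromℕ n) ≡ true
  isRoot-fromℕ zero    = refl
  isRoot-fromℕ (suc n) = isRoot-fromℕ n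

  -- Inverse of inject₁ away from the root (which it sends to F.fromℕ k).
  lower : ∀ {k} → Fin (suc (suc k)) → Fin (suc k)
  lower {zero}  zero       = zero
  lower {zero}  (suc zero) = zero
  lower {suc k} zero       = zero
  lower {suc k} (suc i)    = suc (lower i)

  lower-inject₁ : ∀ {k} (j : Fin (suc k)) → lower (inject₁ j) ≡ j
  lower-inject₁ {zero}  zero    = refl
  lower-inject₁ {suc k} zero    = refl
  lower-inject₁ {suc k} (suc j) = cong suc (lower-inject₁ j)

  inject₁-lower : ∀ {k} (i : Fin (suc (suc k))) → isRoot i ≡ false → inject₁ (lower i) ≡ i
  inject₁-lower {zero}  zero       _ = refl
  inject₁-lower {zero}  (suc zero) ()
  inject₁-lower {suc k} zero       _ = refl
  inject₁-lower {suc k} (suc i) i≢root = cong suc (inject₁-lower i i≢root)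

  -- A new root of colour c₀ whose only child is the old root; all labels move up by one.
  addRoot : ∀ {n} → Bool → Tree (suc n) → Tree (suc (suc n))
  addRoot c₀ (single c)   = grow (single c₀) zero c
  addRoot c₀ (grow t p c) = grow (addRoot c₀ t) (inject₁ p) c

  removeRoot : ∀ {n} → Tree (suc (suc n)) → Tree (suc n)
  removeRoot (grow (single c₀) p c)   = single c
  removeRoot (grow (grow t q c′) p c) = grow (removeRoot (grow t q c′)) (lower p) c

  removeRoot-grow : ∀ {n} (T : Tree (suc (suc n))) p c → removeRoot (grow T p c) ≡ grow (removeRoot T) (lower p) c
  removeRoot-grow (grow T q c′) p c = refl

  removeRoot-addRoot : ∀ {n} c₀ (t : Tree (suc n)) → removeRoot (addRoot c₀ t) ≡ t
  removeRoot-addRoot c₀ (single c)   = refl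
  removeRoot-addRoot c₀ (grow t p c) =
    trans (removeRoot-grow (addRoot c₀ t) (inject₁ p) c)
          (cong₂ (λ t′ p′ → grow t′ p′ c) (removeRoot-addRoot c₀ t) (lower-inject₁ p))

  rootColour-addRoot : ∀ {n} c₀ (t : Tree (suc n)) → rootColour (addRoot c₀ t) ≡ c₀
  rootColour-addRoot c₀ (single c)   = refl
  rootColour-addRoot c₀ (grow t p c) = rootColour-addRoot c₀ t

  blueCount-addRoot : ∀ {n} c₀ (t : Tree (suc n)) → blueCount (addRoot c₀ t) ≡ blueCount t ℕ.+ bit c₀
  blueCount-addRoot c₀ (single c)   = refl
  blueCount-addRoot c₀ (grow t p c) =
    trans (cong (bit c ℕ.+_) (blueCount-addRoot c₀ t)) (sym (ℕₚ.+-assoc (bit c) (blueCount t) (bit c₀)))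

  colour-addRoot : ∀ {n} c₀ (t : Tree (suc n)) i → colour (addRoot c₀ t) (inject₁ i) ≡ colour t i
  colour-addRoot c₀ (single c)   zero    = refl
  colour-addRoot c₀ (grow t p c) zero    = refl
  colour-addRoot c₀ (grow t p c) (suc i) = colour-addRoot c₀ t i

  degree-addRoot : ∀ {n} c₀ (t : Tree (suc n)) i → degree (addRoot c₀ t) (inject₁ i) ≡ degree t i
  degree-addRoot c₀ (single c)   zero    = refl
  degree-addRoot c₀ (grow t p c) zero    = refl
  degree-addRoot c₀ (grow t p c) (suc i) = cong₂ ℕ._+_ (degree-addRoot c₀ t i) (cong bit (==-inject₁ p i))

  rootDegree-addRoot : ∀ {n} c₀ (t : Tree (suc n)) → rootDegree (addRoot c₀ t) ≡ 1
  rootDegree-addRoot c₀ (single c)   = refl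
  rootDegree-addRoot c₀ (grow t p c) =
    cong₂ ℕ._+_ (rootDegree-addRoot c₀ t) (cong bit (trans (==-root (inject₁ p)) (isRoot-inject₁ p)))

  validBelowRoot-addRoot : ∀ {n} c₀ (t : Tree (suc n)) → validBelowRoot (addRoot c₀ t) ≡ valid t
  validBelowRoot-addRoot {n} c₀ t = begin
    validBelowRoot (addRoot c₀ t)
      ≡⟨ allᵇ-last (λ k → isRoot k ∨ validAt (addRoot c₀ t) k) ⟩
    allᵇ (λ i → isRoot (inject₁ i) ∨ validAt (addRoot c₀ t) (inject₁ i)) ∧ (isRoot (F.fromℕ (suc n)) ∨ _)
      ≡⟨ cong₂ _∧_ (allᵇ-cong old-nodes) (cong (_∨ validAt (addRoot c₀ t) (F.fromℕ (suc n))) (isRoot-fromℕ (suc n))) ⟩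
    valid t ∧ true
      ≡⟨ ∧-identityʳ (valid t) ⟩
    valid t ∎
    where
    open ≡-Reasoning
    old-nodes : ∀ i → (isRoot (inject₁ i) ∨ validAt (addRoot c₀ t) (inject₁ i)) ≡ validAt t i
    old-nodes i rewrite isRoot-inject₁ i | colour-addRoot c₀ t i | degree-addRoot c₀ t i = refl

  rootDegree≥1 : ∀ {n} (T : Tree (suc (suc n))) → 1 ℕ.≤ rootDegree T
  rootDegree≥1 (grow (single c₀) zero c)  = s≤s z≤n
  rootDegree≥1 (grow (grow t q c′) p c) = ℕₚ.≤-trans (rootDegree≥1 (grow t q c′)) (ℕₚ.m≤m+n _ _)

  addRoot-removeRoot : ∀ {n} (T : Tree (suc (suc n))) → rootDegree T ≡ 1 → addRoot (rootColour T) (removeRoot T) ≡ T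
  addRoot-removeRoot (grow (single c₀) zero c) _ = refl
  addRoot-removeRoot {suc n} (grow T′@(grow t q c′) p c) degree≡1 with p == F.fromℕ (suc n) in p-root
  ... | true  = ⊥-elim (ℕₚ.<-irrefl refl (ℕₚ.≤-trans (s≤s (rootDegree≥1 T′))
                  (ℕₚ.≤-reflexive (trans (ℕₚ.+-comm 1 (rootDegree T′)) degree≡1))))
  ... | false = cong₂ (λ t′ p′ → grow t′ p′ c)
                  (addRoot-removeRoot T′ (trans (sym (ℕₚ.+-identityʳ (rootDegree T′))) degree≡1))
                  (inject₁-lower p (trans (sym (==-root p)) p-root))

module TreeClasses where

  open import Data.Nat as ℕ using (zero; suc; _≤ᵇ_)
  open import Data.Fin as F using ()
  open import Data.Bool using (true; false; _∧_; _∨_)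
  open import Data.Bool.Properties using (∧-identityʳ; ∧-conicalˡ; ∧-conicalʳ)
  open import Data.Sum using (_⊎_)
  open import Data.Sum.Algebra using (⊎-cong)
  open import Function.Properties.Inverse using (↔-refl; ↔-trans)
  open import Data.Product using (Σ; _,_; proj₁; proj₂)
  open import Relation.Nullary using (Irrelevant)
  open import Function.Base using (id)
  open import Function.Bundles using (mk↔ₛ′)
  open import Relation.Binary.PropositionalEquality
  open Bijections
  open ColouredTrees

  BTreeProps : ℕ → ∀ {n} → Tree n → Set
  BTreeProps m t = blueCount t ≡ m × valid t ≡ true

  BTrees : ℕ → ℕ → Set
  BTrees n m = Σ (Tree n) (BTreeProps m)

  -- A blue root over a set of m-blue B-structures on n labels: the trees counted by e^B.  The root
  -- is only required to be blue, so attaching a further subtree to it keeps it in the class.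
  ETreeProps : ℕ → ∀ {n} → Tree (suc n) → Set
  ETreeProps m t = rootColour t ≡ true × blueCount t ≡ suc m × validBelowRoot t ≡ true

  ETrees : ℕ → ℕ → Set
  ETrees n m = Σ (Tree (suc n)) (ETreeProps m)

  BTreeProps-irrelevant : ∀ {n m} (t : Tree n) → Irrelevant (BTreeProps m t)
  BTreeProps-irrelevant t = ×-irrelevant ℕₚ.≡-irrelevant Bool-≡-irrelevant

  ETreeProps-irrelevant : ∀ {n m} (t : Tree (suc n)) → Irrelevant (ETreeProps m t)
  ETreeProps-irrelevant t = ×-irrelevant Bool-≡-irrelevant (×-irrelevant ℕₚ.≡-irrelevant Bool-≡-irrelevant)

  Decomposed : ℕ → ℕ → Set
  Decomposed n m = Convolution n λ a b → Shuffle a b n × Convolution m λ j k → BTrees (suc a) j × ETrees b k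

  module _ {n m : ℕ} where

    split : (d : Attachment n) → ETreeProps m (attach′ d) → Decomposed n m
    split (a , b , s , L , R) (root-blue , blues , valid-below) =
      a , b , shuffle-size s , s , blueCount L , k , blues-L+k ,
      (L , refl , ∧-conicalˡ (valid L) _ valid-parts) , (R , R-root-blue , blues-R , ∧-conicalʳ (valid L) _ valid-parts)
      where
      valid-parts : valid L ∧ validBelowRoot R ≡ true
      valid-parts = trans (sym (validBelowRoot-attach s L R)) valid-below
      R-root-blue : rootColour R ≡ true
      R-root-blue = trans (sym (rootColour-attach s L R)) root-blue
      k = proj₁ (rootColour⇒blueCount≥1 R R-root-blue)
      blues-R = proj₂ (rootColour⇒blueCount≥1 R R-root-blue)
      blues-L+k : blueCount L ℕ.+ k ≡ m
      blues-L+k = ℕₚ.suc-injective (begin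
        suc (blueCount L ℕ.+ k)     ≡⟨ ℕₚ.+-suc (blueCount L) k ⟨
        blueCount L ℕ.+ suc k       ≡⟨ cong (blueCount L ℕ.+_) blues-R ⟨
        blueCount L ℕ.+ blueCount R ≡⟨ blueCount-attach s L R ⟨
        blueCount (attach s L R)    ≡⟨ blues ⟩
        suc m                       ∎)
        where open ≡-Reasoning

    join : Decomposed n m → ETrees (suc n) m
    join (a , b , _ , s , j , k , j+k≡m , (L , blues-L , valid-L) , (R , root-blue , blues-R , valid-R)) =
      attach s L R ,
      trans (rootColour-attach s L R) root-blue ,
      trans (blueCount-attach s L R) (trans (cong₂ ℕ._+_ blues-L blues-R) (trans (ℕₚ.+-suc j k) (cong suc j+k≡m))) ,
      trans (validBelowRoot-attach s L R) (cong₂ _∧_ valid-L valid-R)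

    attachment : Decomposed n m → Attachment n
    attachment (a , b , _ , s , _ , _ , _ , (L , _) , (R , _)) = a , b , s , L , R

    attachment-split : ∀ d props → attachment (split d props) ≡ d
    attachment-split (a , b , s , L , R) props = refl

    Decomposed-≡ : ∀ (x y : Decomposed n m) → attachment x ≡ attachment y → x ≡ y
    Decomposed-≡ (a , b , a+b , s , j , k , j+k , (L , blues-L , valid-L) , (R , root-R , blues-R , valid-R))
                 (.a , .b , a+b′ , .s , j′ , k′ , j+k′ , (.L , blues-L′ , valid-L′) , (.R , root-R′ , blues-R′ , valid-R′)) refl
      with trans (sym blues-L) blues-L′ | ℕₚ.suc-injective (trans (sym blues-R) blues-R′)
    ... | refl | refl
      rewrite ℕₚ.≡-irrelevant a+b a+b′ | ℕₚ.≡-irrelevant j+k j+k′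
            | ℕₚ.≡-irrelevant blues-L blues-L′ | Bool-≡-irrelevant valid-L valid-L′
            | Bool-≡-irrelevant root-R root-R′ | ℕₚ.≡-irrelevant blues-R blues-R′ | Bool-≡-irrelevant valid-R valid-R′ = refl

    ETrees-decomposition : ETrees (suc n) m ↔ Decomposed n m
    ETrees-decomposition = mk↔ₛ′ to join to-join join-to
      where
      to : ETrees (suc n) m → Decomposed n m
      to (T , props) = split (detach T) (subst (ETreeProps m) (sym (attach-detach T)) props)
      attachment-to : ∀ x → attachment (to x) ≡ detach (proj₁ x)
      attachment-to (T , props) = attachment-split (detach T) (subst (ETreeProps m) (sym (attach-detach T)) props)
      join-split : ∀ d props → proj₁ (join (split d props)) ≡ attach′ d
      join-split (a , b , s , L , R) props = refl
      join-to : ∀ x → join (to x) ≡ x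
      join-to (T , props) = Σ-≡-irrelevant ETreeProps-irrelevant
        (trans (join-split (detach T) (subst (ETreeProps m) (sym (attach-detach T)) props)) (attach-detach T))
      to-join : ∀ y → to (join y) ≡ y
      to-join y@(a , b , _ , s , _ , _ , _ , (L , _) , (R , _)) =
        Decomposed-≡ (to (join y)) y (trans (attachment-to (join y)) (detach-attach s L R))

  RedRootProps : ℕ → ∀ {n} → Tree (suc n) → Set
  RedRootProps m t = rootColour t ≡ false × blueCount t ≡ suc m × valid t ≡ true

  RedRootTrees : ℕ → ℕ → Set
  RedRootTrees n m = Σ (Tree (suc n)) (RedRootProps m)

  BranchingRootProps : ℕ → ∀ {n} → Tree (suc n) → Set
  BranchingRootProps m t = ETreeProps m t × (2 ≤ᵇ rootDegree t) ≡ true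

  UnaryRootProps : ℕ → ∀ {n} → Tree (suc n) → Set
  UnaryRootProps m t = ETreeProps m t × (2 ≤ᵇ rootDegree t) ≡ false

  UnaryRootTrees : ℕ → ℕ → Set
  UnaryRootTrees n m = Σ (Tree (suc n)) (UnaryRootProps (suc m))

  private
    RedRootProps-irrelevant : ∀ {n m} (t : Tree (suc n)) → Irrelevant (RedRootProps m t)
    RedRootProps-irrelevant t = ×-irrelevant Bool-≡-irrelevant (BTreeProps-irrelevant t)

    valid-blue-root : ∀ {n} (t : Tree (suc n)) → rootColour t ≡ true → valid t ≡ validBelowRoot t
    valid-blue-root t root-blue = trans (valid≡validBelowRoot∧root t)
      (trans (cong (λ c → validBelowRoot t ∧ (c ∨ (2 ≤ᵇ rootDegree t))) root-blue) (∧-identityʳ (validBelowRoot t)))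

    valid-red-root : ∀ {n} (t : Tree (suc n)) → rootColour t ≡ false → valid t ≡ validBelowRoot t ∧ (2 ≤ᵇ rootDegree t)
    valid-red-root t root-red = trans (valid≡validBelowRoot∧root t)
      (cong (λ c → validBelowRoot t ∧ (c ∨ (2 ≤ᵇ rootDegree t))) root-red)

  BTrees-by-root-colour : ∀ n m → BTrees (suc n) (suc m) ↔ (ETrees n m ⊎ RedRootTrees n m)
  BTrees-by-root-colour n m = ↔-trans (Σ-split rootColour) (⊎-cong blue-root red-root)
    where
    blue-root : Σ (Tree (suc n)) (λ t → BTreeProps (suc m) t × rootColour t ≡ true) ↔ ETrees n m
    blue-root = Σ-↔-irrelevant (λ t → ×-irrelevant (BTreeProps-irrelevant t) Bool-≡-irrelevant) ETreeProps-irrelevant id id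
      (λ t ((blues , valid-t) , root-blue) → root-blue , blues , trans (sym (valid-blue-root t root-blue)) valid-t)
      (λ t (root-blue , blues , valid-below) → (blues , trans (valid-blue-root t root-blue) valid-below) , root-blue)
      (λ _ _ → refl) (λ _ _ → refl)
    red-root : Σ (Tree (suc n)) (λ t → BTreeProps (suc m) t × rootColour t ≡ false) ↔ RedRootTrees n m
    red-root = Σ-↔-irrelevant (λ t → ×-irrelevant (BTreeProps-irrelevant t) Bool-≡-irrelevant) RedRootProps-irrelevant id id
      (λ t ((blues , valid-t) , root-red) → root-red , blues , valid-t)
      (λ t (root-red , blues , valid-t) → (blues , valid-t) , root-red)
      (λ _ _ → refl) (λ _ _ → refl)

  recolourRoot-red : ∀ {n m} (t : Tree (suc n)) → BranchingRootProps (suc m) t → RedRootProps m (recolourRoot false t)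
  recolourRoot-red {n} t ((root-blue , blues , valid-below) , branching) =
    rootColour-recolourRoot false t ,
    ℕₚ.suc-injective (trans (blueCount-recolourRoot-red t root-blue) blues) ,
    trans (valid-red-root (recolourRoot false t) (rootColour-recolourRoot false t))
          (cong₂ _∧_ (trans (validBelowRoot-recolourRoot false t) valid-below)
                     (trans (cong (2 ≤ᵇ_) (degree-recolourRoot false t (F.fromℕ n))) branching))

  recolourRoot-blue : ∀ {n m} (t : Tree (suc n)) → RedRootProps m t → BranchingRootProps (suc m) (recolourRoot true t)
  recolourRoot-blue {n} t (root-red , blues , valid-t) =
    (rootColour-recolourRoot true t ,
     trans (blueCount-recolourRoot-blue t root-red) (cong suc blues) ,
     trans (validBelowRoot-recolourRoot true t) (∧-conicalˡ (validBelowRoot t) _ valid-parts)) ,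
    trans (cong (2 ≤ᵇ_) (degree-recolourRoot true t (F.fromℕ n))) (∧-conicalʳ (validBelowRoot t) _ valid-parts)
    where
    valid-parts : validBelowRoot t ∧ (2 ≤ᵇ rootDegree t) ≡ true
    valid-parts = trans (sym (valid-red-root t root-red)) valid-t

  ETrees-by-root-degree : ∀ n m → ETrees n (suc m) ↔ (RedRootTrees n m ⊎ UnaryRootTrees n m)
  ETrees-by-root-degree n m = ↔-trans (Σ-split (λ t → 2 ≤ᵇ rootDegree t)) (⊎-cong recolour ↔-refl)
    where
    recolour : Σ (Tree (suc n)) (BranchingRootProps (suc m)) ↔ RedRootTrees n m
    recolour = Σ-↔-irrelevant (λ t → ×-irrelevant (ETreeProps-irrelevant t) Bool-≡-irrelevant) RedRootProps-irrelevant
      (recolourRoot false) (recolourRoot true) recolourRoot-red recolourRoot-blue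
      (λ t (root-red , _) → trans (recolourRoot-recolourRoot false true t)
                              (trans (cong (λ c → recolourRoot c t) (sym root-red)) (recolourRoot-rootColour t)))
      (λ t ((root-blue , _) , _) → trans (recolourRoot-recolourRoot true false t)
                                     (trans (cong (λ c → recolourRoot c t) (sym root-blue)) (recolourRoot-rootColour t)))

  BTrees↔UnaryRootTrees : ∀ n m → BTrees (suc n) (suc m) ↔ UnaryRootTrees (suc n) m
  BTrees↔UnaryRootTrees n m =
    Σ-↔-irrelevant BTreeProps-irrelevant (λ t → ×-irrelevant (ETreeProps-irrelevant t) Bool-≡-irrelevant)
    (addRoot true) removeRoot to-unary from-unary add-remove (λ t _ → removeRoot-addRoot true t)
    where
    to-unary : ∀ t → BTreeProps (suc m) t → UnaryRootProps (suc m) (addRoot true t)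
    to-unary t (blues , valid-t) =
      (rootColour-addRoot true t ,
       trans (blueCount-addRoot true t) (trans (cong (ℕ._+ 1) blues) (ℕₚ.+-comm (suc m) 1)) ,
       trans (validBelowRoot-addRoot true t) valid-t) ,
      cong (2 ≤ᵇ_) (rootDegree-addRoot true t)
    rootDegree≡1 : ∀ (T : Tree (suc (suc n))) → (2 ≤ᵇ rootDegree T) ≡ false → rootDegree T ≡ 1
    rootDegree≡1 T unary with rootDegree T | rootDegree≥1 T
    ... | suc zero    | _ = refl
    ... | suc (suc d) | _ with () ← unary
    add-remove : ∀ T → UnaryRootProps (suc m) T → addRoot true (removeRoot T) ≡ T
    add-remove T ((root-blue , _) , unary) =
      trans (cong (λ c → addRoot c (removeRoot T)) (sym root-blue)) (addRoot-removeRoot T (rootDegree≡1 T unary))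
    from-unary : ∀ T → UnaryRootProps (suc m) T → BTreeProps (suc m) (removeRoot T)
    from-unary T props@((_ , blues , valid-below) , _) =
      ℕₚ.suc-injective (trans (ℕₚ.+-comm 1 _) (trans (sym (blueCount-addRoot true (removeRoot T)))
                                                    (trans (cong blueCount (add-remove T props)) blues))) ,
      trans (sym (validBelowRoot-addRoot true (removeRoot T))) (trans (cong validBelowRoot (add-remove T props)) valid-below)

module ParentMapEncoding where

  open import Data.Nat as ℕ using (zero; suc; _≤ᵇ_)
  open import Data.Fin as F using (zero; suc; inject₁; toℕ; opposite)
  import Data.Fin.Properties as Fₚ
  open import Data.Bool using (Bool; true; false; _∨_)
  open import Data.Bool.Properties using (T-≡)
  open import Function.Bundles using (Equivalence)
  open import Data.Unit using (tt)
  open import Data.Vec using (Vec; []; _∷_; _∷ʳ_; lookup; count; init; last; initLast; allFin)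
  import Data.Vec.Properties as Vecₚ
  open import Data.Vec.Relation.Unary.All using (All)
  import Data.Vec.Relation.Unary.All as All
  open import Data.Vec.Relation.Unary.All.Properties using (tabulate⁺; tabulate⁻)
  import Data.List as List
  open import Data.Product using (_,_; proj₁; proj₂)
  open import Function.Base using (_∘_; id)
  open import Function.Bundles using (mk↔ₛ′)
  open import Relation.Nullary using (does; Irrelevant)
  open import Relation.Nullary.Decidable using (T?; dec-true; dec-false)
  open import Relation.Binary.PropositionalEquality
  open Bijections
  open ColouredTrees
  open TreeClasses

  -- Node i of a Tree is the node labelled toℕ (opposite i).
  encode : ∀ {n} → Tree (suc n) → IncTree (suc n) × Vec Bool (suc n)
  encode (single c)   = root , c ∷ []
  encode (grow t p c) = (proj₁ (encode t) ⊕ opposite p) , (proj₂ (encode t) ∷ʳ c)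

  decode : ∀ {n} → IncTree (suc n) → Vec Bool (suc n) → Tree (suc n)
  decode root     (c ∷ []) = single c
  decode {suc n} (t ⊕ p) v = grow (decode t (init v)) (opposite p) (last v)

  decode-encode : ∀ {n} (x : Tree (suc n)) → decode (proj₁ (encode x)) (proj₂ (encode x)) ≡ x
  decode-encode (single c) = refl
  decode-encode (grow t p c)
    rewrite Vecₚ.init-∷ʳ c (proj₂ (encode t)) | Vecₚ.last-∷ʳ c (proj₂ (encode t))
          | Fₚ.opposite-involutive p | decode-encode t = refl

  encode-decode : ∀ {n} (t : IncTree (suc n)) v → encode (decode t v) ≡ (t , v)
  encode-decode root (c ∷ []) = refl
  encode-decode {suc n} (t ⊕ p) v rewrite encode-decode t (init v) | Fₚ.opposite-involutive p =
    cong (t ⊕ p ,_) (sym (proj₂ (proj₂ (initLast v))))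

  count-∷ʳ : ∀ {n} (v : Vec Bool n) c → count T? (v ∷ʳ c) ≡ count T? v ℕ.+ bit c
  count-∷ʳ []          true  = refl
  count-∷ʳ []          false = refl
  count-∷ʳ (true ∷ v)  c     = cong suc (count-∷ʳ v c)
  count-∷ʳ (false ∷ v) c     = count-∷ʳ v c

  count-encode : ∀ {n} (x : Tree (suc n)) → count T? (proj₂ (encode x)) ≡ blueCount x
  count-encode (single true)  = refl
  count-encode (single false) = refl
  count-encode (grow t p c)   =
    trans (count-∷ʳ (proj₂ (encode t)) c) (trans (cong (ℕ._+ bit c) (count-encode t)) (ℕₚ.+-comm (blueCount t) (bit c)))

  lookup-∷ʳ-last : ∀ {n} (v : Vec Bool n) c → lookup (v ∷ʳ c) (F.fromℕ n) ≡ c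
  lookup-∷ʳ-last []      c = refl
  lookup-∷ʳ-last (x ∷ v) c = lookup-∷ʳ-last v c

  lookup-∷ʳ-inject₁ : ∀ {n} (v : Vec Bool n) c k → lookup (v ∷ʳ c) (inject₁ k) ≡ lookup v k
  lookup-∷ʳ-inject₁ (x ∷ v) c zero    = refl
  lookup-∷ʳ-inject₁ (x ∷ v) c (suc k) = lookup-∷ʳ-inject₁ v c k

  colour-encode : ∀ {n} (x : Tree (suc n)) i → colour x i ≡ lookup (proj₂ (encode x)) (opposite i)
  colour-encode (single c)   zero    = refl
  colour-encode (grow t p c) zero    = sym (lookup-∷ʳ-last (proj₂ (encode t)) c)
  colour-encode (grow t p c) (suc i) =
    trans (colour-encode t i) (sym (lookup-∷ʳ-inject₁ (proj₂ (encode t)) c (opposite i)))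

  childCount : ∀ {n} → IncTree n → ℕ → ℕ
  childCount t k = List.length (List.filter (λ q → q ℕ.≟ k) (parents t))

  childCount-⊕ : ∀ {n} (t : IncTree n) p k → childCount (t ⊕ p) k ≡ bit (does (toℕ p ℕ.≟ k)) ℕ.+ childCount t k
  childCount-⊕ t p k with does (toℕ p ℕ.≟ k)
  ... | true  = refl
  ... | false = refl

  childCount-≥ : ∀ {N} (t : IncTree N) k → N ℕ.≤ k → childCount t k ≡ 0
  childCount-≥ root k _ = refl
  childCount-≥ {suc N} (t ⊕ p) k N<k = begin
    childCount (t ⊕ p) k
      ≡⟨ childCount-⊕ t p k ⟩
    bit (does (toℕ p ℕ.≟ k)) ℕ.+ childCount t k
      ≡⟨ cong (λ b → bit b ℕ.+ childCount t k) (dec-false (toℕ p ℕ.≟ k) p≢k) ⟩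
    childCount t k
      ≡⟨ childCount-≥ t k N≤k ⟩
    0 ∎
    where
    open ≡-Reasoning
    N≤k = ℕₚ.≤-trans (ℕₚ.n≤1+n N) N<k
    p≢k : toℕ p ≢ k
    p≢k p≡k = ℕₚ.<-irrefl p≡k (ℕₚ.<-≤-trans (Fₚ.toℕ<n p) N≤k)

  ==-sound : ∀ {n} {p j : Fin n} → (p == j) ≡ true → p ≡ j
  ==-sound {p = zero}  {zero}  _  = refl
  ==-sound {p = suc p} {suc j} eq = cong suc (==-sound eq)

  ==-refl : ∀ {n} (p : Fin n) → (p == p) ≡ true
  ==-refl zero    = refl
  ==-refl (suc p) = ==-refl p

  bit-==-opposite : ∀ {n} (p j : Fin n) → bit (p == j) ≡ bit (does (toℕ (opposite p) ℕ.≟ toℕ (opposite j)))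
  bit-==-opposite p j with p == j in p==j
  ... | true  = sym (cong bit (dec-true (toℕ (opposite p) ℕ.≟ toℕ (opposite j)) (cong (toℕ ∘ opposite) (==-sound p==j))))
  ... | false = sym (cong bit (dec-false (toℕ (opposite p) ℕ.≟ toℕ (opposite j))
                                         (λ eq → p≢j (opposite-injective (Fₚ.toℕ-injective eq)))))
    where
    p≢j : p ≢ j
    p≢j refl with () ← trans (sym p==j) (==-refl p)
    opposite-injective : opposite p ≡ opposite j → p ≡ j
    opposite-injective eq = trans (sym (Fₚ.opposite-involutive p)) (trans (cong opposite eq) (Fₚ.opposite-involutive j))

  degree-encode : ∀ {n} (x : Tree (suc n)) i → degree x i ≡ childCount (proj₁ (encode x)) (toℕ (opposite i))
  degree-encode (single c) zero = refl
  degree-encode {suc n} (grow t p c) zero = sym (begin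
    childCount (t′ ⊕ opposite p) (toℕ (F.fromℕ (suc n)))                ≡⟨ childCount-⊕ t′ (opposite p) _ ⟩
    bit (does (toℕ (opposite p) ℕ.≟ toℕ (F.fromℕ (suc n)))) ℕ.+ childCount t′ (toℕ (F.fromℕ (suc n)))
      ≡⟨ cong₂ (λ b c → bit b ℕ.+ c) (dec-false (_ ℕ.≟ _) newest-childless)
                                      (childCount-≥ t′ _ (ℕₚ.≤-reflexive (sym (Fₚ.toℕ-fromℕ (suc n))))) ⟩
    0 ∎)
    where
    open ≡-Reasoning
    t′ = proj₁ (encode t)
    newest-childless : toℕ (opposite p) ≢ toℕ (F.fromℕ (suc n))
    newest-childless eq = ℕₚ.<-irrefl (trans eq (Fₚ.toℕ-fromℕ (suc n))) (Fₚ.toℕ<n (opposite p))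
  degree-encode {suc n} (grow t p c) (suc i) = begin
    degree t i ℕ.+ bit (p == i)
      ≡⟨ cong₂ ℕ._+_ (degree-encode t i) (bit-==-opposite p i) ⟩
    childCount t′ (toℕ (opposite i)) ℕ.+ bit (does (toℕ (opposite p) ℕ.≟ toℕ (opposite i)))
      ≡⟨ ℕₚ.+-comm (childCount t′ (toℕ (opposite i))) _ ⟩
    bit (does (toℕ (opposite p) ℕ.≟ toℕ (opposite i))) ℕ.+ childCount t′ (toℕ (opposite i))
      ≡⟨ childCount-⊕ t′ (opposite p) (toℕ (opposite i)) ⟨
    childCount (t′ ⊕ opposite p) (toℕ (opposite i))
      ≡⟨ cong (childCount (t′ ⊕ opposite p)) (Fₚ.toℕ-inject₁ (opposite i)) ⟨
    childCount (t′ ⊕ opposite p) (toℕ (opposite (suc i))) ∎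
    where
    open ≡-Reasoning
    t′ = proj₁ (encode t)

  validAt-encode : ∀ {n} (x : Tree (suc n)) i →
                   validAt x i ≡ (lookup (proj₂ (encode x)) (opposite i) ∨ (2 ≤ᵇ children (proj₁ (encode x)) (opposite i)))
  validAt-encode x i = cong₂ (λ c d → c ∨ (2 ≤ᵇ d)) (colour-encode x i) (degree-encode x i)

  ColourOK⇒ : ∀ c k → ColourOK c k → (c ∨ (2 ≤ᵇ k)) ≡ true
  ColourOK⇒ true  k _   = refl
  ColourOK⇒ false k 2≤k = Equivalence.to T-≡ (ℕₚ.≤⇒≤ᵇ 2≤k)

  ColourOK⇐ : ∀ c k → (c ∨ (2 ≤ᵇ k)) ≡ true → ColourOK c k
  ColourOK⇐ true  k _  = tt
  ColourOK⇐ false k ok = ℕₚ.≤ᵇ⇒≤ 2 k (Equivalence.from T-≡ ok)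

  ColourOK-irrelevant : ∀ c k → Irrelevant (ColourOK c k)
  ColourOK-irrelevant true  k tt tt = refl
  ColourOK-irrelevant false k p  q  = ℕₚ.≤-irrelevant p q

  RedNodesOK : ∀ {n} → IncTree n → Vec Bool n → Set
  RedNodesOK {n} t v = All (λ i → ColourOK (lookup v i) (children t i)) (allFin n)

  valid-decode : ∀ {n} (t : IncTree (suc n)) v → RedNodesOK t v → valid (decode t v) ≡ true
  valid-decode t v ok = allᵇ-complete (validAt (decode t v)) λ i → begin
    validAt (decode t v) i
      ≡⟨ validAt-encode (decode t v) i ⟩
    lookup (proj₂ (encode (decode t v))) (opposite i) ∨ (2 ≤ᵇ children (proj₁ (encode (decode t v))) (opposite i))
      ≡⟨ cong (λ (t , v) → lookup v (opposite i) ∨ (2 ≤ᵇ children t (opposite i))) (encode-decode t v) ⟩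
    lookup v (opposite i) ∨ (2 ≤ᵇ children t (opposite i))
      ≡⟨ ColourOK⇒ _ _ (tabulate⁻ {f = id} ok (opposite i)) ⟩
    true ∎
    where open ≡-Reasoning

  encode-valid : ∀ {n} (x : Tree (suc n)) → valid x ≡ true → RedNodesOK (proj₁ (encode x)) (proj₂ (encode x))
  encode-valid x ok = tabulate⁺ {f = id} λ i → ColourOK⇐ _ _
    (subst (λ j → (lookup (proj₂ (encode x)) j ∨ (2 ≤ᵇ children (proj₁ (encode x)) j)) ≡ true)
           (Fₚ.opposite-involutive i)
           (trans (sym (validAt-encode x (opposite i))) (allᵇ-sound (validAt x) ok (opposite i))))

  𝓑-≡ : ∀ {n m} (r r′ : 𝓑 n m) → 𝓑.tree r ≡ 𝓑.tree r′ → 𝓑.colour r ≡ 𝓑.colour r′ → r ≡ r′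
  𝓑-≡ record { tree = t ; colour = v ; blues = b ; redOK = o }
      record { tree = .t ; colour = .v ; blues = b′ ; redOK = o′ } refl refl
    rewrite ℕₚ.≡-irrelevant b b′ | All.irrelevant (λ {i} → ColourOK-irrelevant (lookup v i) (children t i)) o o′ = refl

  𝓑↔BTrees : ∀ n m → 𝓑 (suc n) m ↔ BTrees (suc n) m
  𝓑↔BTrees n m = mk↔ₛ′ to from to-from from-to
    where
    to : 𝓑 (suc n) m → BTrees (suc n) m
    to r = decode t v ,
           trans (sym (trans (cong (count T? ∘ proj₂) (sym (encode-decode t v))) (count-encode (decode t v)))) (𝓑.blues r) ,
           valid-decode t v (𝓑.redOK r)
      where t = 𝓑.tree r ; v = 𝓑.colour r
    from : BTrees (suc n) m → 𝓑 (suc n) m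
    from (x , blues , valid-x) = record
      { tree = proj₁ (encode x) ; colour = proj₂ (encode x)
      ; blues = trans (count-encode x) blues ; redOK = encode-valid x valid-x }
    to-from : ∀ y → to (from y) ≡ y
    to-from (x , props) = Σ-≡-irrelevant BTreeProps-irrelevant (decode-encode x)
    from-to : ∀ r → from (to r) ≡ r
    from-to r = 𝓑-≡ (from (to r)) r (cong proj₁ (encode-decode (𝓑.tree r) (𝓑.colour r)))
                                   (cong proj₂ (encode-decode (𝓑.tree r) (𝓑.colour r)))

module Counting (b : ℕ → ℕ → ℕ) (b-count : ∀ n m → Fin (b (suc n) (suc m)) ↔ TreeClasses.BTrees (suc n) (suc m)) where

  open import Data.Nat as ℕ using (zero; suc; _∸_; _<_; s≤s)
  open import Data.Fin using (zero)
  open import Data.Fin.Properties using (+↔⊎; *↔×)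
  open import Data.Fin.Permutation using (↔⇒≡)
  open import Data.Bool using (true; false)
  open import Data.Sum using (_⊎_; inj₁; inj₂)
  open import Data.Sum.Algebra using (⊎-cong; ⊎-assoc; ⊎-comm)
  open import Data.Product using (_,_)
  open import Data.Product.Algebra using (×-cong)
  open import Level using (0ℓ)
  open import Function.Bundles using (mk↔ₛ′)
  open import Relation.Nullary using (¬_)
  open import Function.Related.Propositional using (module EquationalReasoning)
  open import Function.Properties.Inverse using (↔-refl; ↔-sym; ↔-trans)
  open import Relation.Binary.PropositionalEquality
  open ExponentialGeneratingFunctions using (shuffles; labelledProduct; unit; positivePart; y+1⊠ℕ)
  open Bijections
  open ColouredTrees
  open TreeClasses

  Shuffle↔Fin : ∀ a c n → a ℕ.+ c ≡ n → Shuffle a c n ↔ Fin (shuffles a c)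
  Shuffle↔Fin zero    zero    .0 refl = mk↔ₛ′ (λ _ → zero) (λ _ → []) (λ { zero → refl }) (λ { [] → refl })
  Shuffle↔Fin zero    (suc c) ._ refl =
    ↔-trans (mk↔ₛ′ (λ { (right s) → s }) right (λ _ → refl) (λ { (right s) → refl })) (Shuffle↔Fin zero c c refl)
  Shuffle↔Fin (suc a) zero    ._ refl =
    ↔-trans (mk↔ₛ′ (λ { (left s) → s }) left (λ _ → refl) (λ { (left s) → refl }))
            (subst (λ k → Shuffle a zero (a ℕ.+ 0) ↔ Fin k) (shuffles-zeroʳ a) (Shuffle↔Fin a zero _ refl))
    where
    shuffles-zeroʳ : ∀ a → shuffles a zero ≡ 1
    shuffles-zeroʳ zero    = refl
    shuffles-zeroʳ (suc a) = refl
  Shuffle↔Fin (suc a) (suc c) ._ refl = ↔-trans first-step (↔-trans (⊎-cong (Shuffle↔Fin a (suc c) _ refl)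
                                                                              (Shuffle↔Fin (suc a) c _ (sym (ℕₚ.+-suc a c))))
                                                                     (↔-sym +↔⊎))
    where
    first-step : Shuffle (suc a) (suc c) (suc (a ℕ.+ suc c)) ↔
                 (Shuffle a (suc c) (a ℕ.+ suc c) ⊎ Shuffle (suc a) c (a ℕ.+ suc c))
    first-step = mk↔ₛ′ (λ { (left s) → inj₁ s ; (right s) → inj₂ s })
                       (λ { (inj₁ s) → left s ; (inj₂ s) → right s })
                       (λ { (inj₁ s) → refl ; (inj₂ s) → refl }) (λ { (left s) → refl ; (right s) → refl })

  b₊ : ℕ → ℕ → ℕ
  b₊ i = positivePart b (suc i)

  BTrees-without-blue : ∀ n → ¬ BTrees (suc n) 0
  BTrees-without-blue n (t , blues , valid-t) with () ← ℕₚ.≤-trans (valid⇒blueCount≥1 t valid-t) (ℕₚ.≤-reflexive blues)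

  b₊-count : ∀ a j → Fin (b₊ a j) ↔ BTrees (suc a) j
  b₊-count a zero    = empty↔ (λ ()) (BTrees-without-blue a)
  b₊-count a (suc j) = b-count a j

  unit-count : ∀ m → Fin (unit 0 m) ↔ ETrees 0 m
  unit-count zero    = mk↔ₛ′ (λ _ → single true , refl , refl , refl) (λ _ → zero)
                             (λ { (single true , _) → Σ-≡-irrelevant ETreeProps-irrelevant refl }) (λ { zero → refl })
  unit-count (suc m) = empty↔ (λ ()) (λ { (single true , _ , () , _) ; (single false , () , _) })

  labelledProduct-count : ∀ n (c : ℕ → ℕ → ℕ) → (∀ k m → k ℕ.≤ n → Fin (c k m) ↔ ETrees k m) →
                          ∀ m → Fin (labelledProduct b₊ c n m) ↔ ETrees (suc n) m
  labelledProduct-count n c c-count m = begin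
    Fin (labelledProduct b₊ c n m)
      ↔⟨ Fin-∑↔Convolution n (λ a d → ℕ⟦x⟧.∑ m (λ j → shuffles a d ℕ.* (b₊ a j ℕ.* c d (m ∸ j)))) ⟩
    Convolution n (λ a d → Fin (ℕ⟦x⟧.∑ m (λ j → shuffles a d ℕ.* (b₊ a j ℕ.* c d (m ∸ j)))))
      ↔⟨ Convolution-cong (λ a d a+d≡n → ↔-trans (Fin-∑↔Convolution m _)
                                                 (↔-trans (Convolution-cong (pieces a d a+d≡n)) Convolution-×ˡ)) ⟩
    Decomposed n m
      ↔⟨ ETrees-decomposition ⟨
    ETrees (suc n) m ∎
    where
    open EquationalReasoning
    pieces : ∀ a d → a ℕ.+ d ≡ n → ∀ j k → j ℕ.+ k ≡ m →
             Fin (shuffles a d ℕ.* (b₊ a j ℕ.* c d k)) ↔ (Shuffle a d n × BTrees (suc a) j × ETrees d k)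
    pieces a d a+d≡n j k _ = ↔-trans *↔× (×-cong (↔-sym (Shuffle↔Fin a d n a+d≡n))
                                         (↔-trans *↔× (×-cong (b₊-count a j) (c-count d k d≤n))))
      where d≤n = ℕₚ.≤-trans (ℕₚ.m≤n+m d a) (ℕₚ.≤-reflexive a+d≡n)

  -- countWithin f n m counts ETrees n m once n < f; the bound f makes the recursion structural.
  countWithin : ℕ → ℕ → ℕ → ℕ
  countWithin zero    n       m = 0
  countWithin (suc f) zero    m = unit 0 m
  countWithin (suc f) (suc n) m = labelledProduct b₊ (countWithin f) n m

  countWithin-count : ∀ f n m → n < f → Fin (countWithin f n m) ↔ ETrees n m
  countWithin-count (suc f) zero    m _         = unit-count m
  countWithin-count (suc f) (suc n) m (s≤s n<f) =
    labelledProduct-count n (countWithin f) (λ k m k≤n → countWithin-count f k m (ℕₚ.≤-<-trans k≤n n<f)) m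

  e : ℕ → ℕ → ℕ
  e n m = countWithin (suc n) n m

  e-count : ∀ n m → Fin (e n m) ↔ ETrees n m
  e-count n m = countWithin-count (suc n) n m (ℕₚ.n<1+n n)

  e-zero : ∀ m → e 0 m ≡ unit 0 m
  e-zero m = refl

  e-suc : ∀ n m → e (suc n) m ≡ labelledProduct b₊ e n m
  e-suc n m = ↔⇒≡ (↔-trans (e-count (suc n) m) (↔-sym (labelledProduct-count n e (λ k m _ → e-count k m) m)))

  e-without-blue : ∀ n → e n 0 ≡ unit n 0
  e-without-blue zero    = refl
  e-without-blue (suc n) =
    trans (e-suc n 0) (ℕ⟦x⟧.∑-zero n (λ a _ → trans (ℕₚ.+-identityʳ _) (ℕₚ.*-zeroʳ (shuffles a (n ∸ a)))))

  unary-count : ∀ n m → Fin (positivePart b n (suc m)) ↔ UnaryRootTrees n m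
  unary-count zero    m = empty↔ (λ ()) (λ { (single true , (_ , () , _) , _) ; (single false , (() , _) , _) })
  unary-count (suc n) m = ↔-trans (b-count n m) (BTrees↔UnaryRootTrees n m)

  recolouring : ∀ n m → Fin (b (suc n) (suc m) ℕ.+ positivePart b n (suc m)) ↔ Fin (e n (suc m) ℕ.+ e n m)
  recolouring n m = begin
    Fin (b (suc n) (suc m) ℕ.+ positivePart b n (suc m))
      ↔⟨ +↔⊎ ⟩
    (Fin (b (suc n) (suc m)) ⊎ Fin (positivePart b n (suc m)))
      ↔⟨ ⊎-cong (↔-trans (b-count n m) (BTrees-by-root-colour n m)) (unary-count n m) ⟩
    ((ETrees n m ⊎ RedRootTrees n m) ⊎ UnaryRootTrees n m)
      ↔⟨ ⊎-assoc 0ℓ _ _ _ ⟩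
    (ETrees n m ⊎ (RedRootTrees n m ⊎ UnaryRootTrees n m))
      ↔⟨ ⊎-cong ↔-refl (ETrees-by-root-degree n m) ⟨
    (ETrees n m ⊎ ETrees n (suc m))
      ↔⟨ ⊎-comm _ _ ⟩
    (ETrees n (suc m) ⊎ ETrees n m)
      ↔⟨ ⊎-cong (e-count n (suc m)) (e-count n m) ⟨
    (Fin (e n (suc m)) ⊎ Fin (e n m))
      ↔⟨ +↔⊎ ⟨
    Fin (e n (suc m) ℕ.+ e n m) ∎
    where open EquationalReasoning

  e-recolour : ∀ n m → positivePart b (suc n) m ℕ.+ unit n m ℕ.+ positivePart b n m ≡ y+1⊠ℕ e n m
  e-recolour zero    zero    = refl
  e-recolour (suc n) zero    = sym (e-without-blue (suc n))
  e-recolour n       (suc m) = begin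
    b (suc n) (suc m) ℕ.+ unit n (suc m) ℕ.+ positivePart b n (suc m)
      ≡⟨ cong (λ k → b (suc n) (suc m) ℕ.+ k ℕ.+ positivePart b n (suc m)) (unit-suc n) ⟩
    b (suc n) (suc m) ℕ.+ 0 ℕ.+ positivePart b n (suc m)
      ≡⟨ cong (ℕ._+ positivePart b n (suc m)) (ℕₚ.+-identityʳ _) ⟩
    b (suc n) (suc m) ℕ.+ positivePart b n (suc m)
      ≡⟨ ↔⇒≡ (recolouring n m) ⟩
    e n (suc m) ℕ.+ e n m ∎
    where
    open ≡-Reasoning
    unit-suc : ∀ n → unit n (suc m) ≡ 0
    unit-suc zero    = refl
    unit-suc (suc n) = refl

open import Data.Nat using (z≤n; s≤s)
open import Data.Product using (_,_)
open import Function.Properties.Inverse using (↔-trans)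
open import Relation.Binary.PropositionalEquality using (refl)

theorem5p2 : (b : ℕ → ℕ → ℕ) →
    (∀ n m → 1 ≤ n → 1 ≤ m → Fin (b n m) ↔ 𝓑 n m) →
    (∀ n m → ∂x (Bseries b) n m
               ≡ ((y+1⊠ (expS (Bseries b)) ⊟ Bseries b) ⊟ oneS) n m)
    × (∀ m → Bseries b 0 m ≡ 0ℚ)
theorem5p2 b b-counts-𝓑 = ExponentialGeneratingFunctions.Bseries-ode b e e-zero e-suc e-recolour , λ _ → refl
  where
  open Counting b (λ n m → ↔-trans (b-counts-𝓑 (suc n) (suc m) (s≤s z≤n) (s≤s z≤n))
                                   (ParentMapEncoding.𝓑↔BTrees n (suc m)))
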